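{- Let $P$ and $Q$ be graded posets of ranks $m$ and $n$ respectively (each with a minimum and maximum element). Then $$\Theta(\Psi(P\times Q))=\begin{bmatrix} m+n\\ n\end{bmatrix}\cdot\Theta(\Psi(P))\cdot\Theta(\Psi(Q)),$$ where $P\times Q$ is the Cartesian product with componentwise order.
   Context: For a graded poset $R$ of rank $r$ with minimum $\hat0$, maximum $\hat1$ and rank function $\rho$, its $\mathbf{a}\mathbf{b}$-index is $\Psi(R)=\sum_{S\subseteq\{1,\dots,r-1\}}f_Sv_S\in\mathbb{Z}\langle \mathbf{a},\mathbf{b}\rangle$ (non-commuting variables), where $f_S$ counts chains $\hat0<x_1<\dots<x_k<\hat1$ with $\{\rho(x_1),\dots,\rho(x_k)\}=S$ and $v_S=v_1\cdots v_{r-1}$ with $v_i=\mathbf{b}$ if $i\in S$, $v_i=\mathbf{a}-\mathbf{b}$ otherwise. The Major MacMahon map $\Theta:\mathbb{Z}\langle \mathbf{a},\mathbf{b}\rangle\to\mathbb{Z}[q]$ is linear with $\Theta(u_1\cdots u_\ell)=\prod_{i:\,u_i=\mathbf{b}}q^i$ on monomials. The Gaussian coefficient is $\begin{bmatrix} m+n\\ n\end{bmatrix}=\frac{[m+n]!}{[m]!\,[n]!}$ with $[k]=1+q+\dots+q^{k-1}$ and $[k]!=[k]\cdots[1]$. -}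

module Defs where

open import Data.Bool using (Bool; true; false; _∧_; not; if_then_else_; T)
open import Data.Nat as ℕ using (ℕ; zero; suc; _∸_; _≡ᵇ_)
open import Data.Integer as ℤ using (ℤ; +_)
open import Data.Fin as Fin using (Fin; combine; remQuot)
open import Data.Product using (_×_; _,_; proj₁; proj₂; ∃)
open import Data.List using (List; []; _∷_; map; concatMap; _++_)
open import Relation.Nullary using (¬_)
open import Relation.Nullary.Decidable using (⌊_⌋)
open import Relation.Binary.PropositionalEquality using (_≡_; _≢_)

Poly : Set
Poly = ℕ → ℤ

_≈ₚ_ : Poly → Poly → Set
f ≈ₚ g = ∀ k → f k ≡ g k

infix 4 _≈ₚ_
infixl 6 _+ₚ_
infixl 7 _*ₚ_

0ₚ : Poly
0ₚ _ = + 0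

qpow : ℕ → Poly
qpow e k = if e ≡ᵇ k then + 1 else + 0

1ₚ : Poly
1ₚ = qpow 0

_+ₚ_ : Poly → Poly → Poly
(f +ₚ g) k = f k ℤ.+ g k

_·ₚ_ : ℤ → Poly → Poly
(c ·ₚ f) k = c ℤ.* f k

sumBelow : ℕ → (ℕ → ℤ) → ℤ
sumBelow zero    h = + 0
sumBelow (suc n) h = sumBelow n h ℤ.+ h n

_*ₚ_ : Poly → Poly → Poly
(f *ₚ g) k = sumBelow (suc k) (λ i → f i ℤ.* g (k ∸ i))

qint : ℕ → Poly
qint k j = if ⌊ j ℕ.<? k ⌋ then + 1 else + 0

qfact : ℕ → Poly
qfact zero    = 1ₚ
qfact (suc k) = qint (suc k) *ₚ qfact k

-- Non-commutative polynomials ℤ⟨a,b⟩ as formal ℤ-linear combinations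
-- of words.

data Letter : Set where
  𝐚 𝐛 : Letter

ABPoly : Set
ABPoly = List (ℤ × List Letter)

scaleAB : ℤ → ABPoly → ABPoly
scaleAB c = map (λ t → (c ℤ.* proj₁ t , proj₂ t))

_⊗_ : ABPoly → ABPoly → ABPoly
x ⊗ y = concatMap (λ t → map (λ s → (proj₁ t ℤ.* proj₁ s , proj₂ t ++ proj₂ s)) y) x

-- Major MacMahon map on a word: q^(sum of positions i (1-based) with u_i = b)
bPosSum : ℕ → List Letter → ℕ
bPosSum i []       = 0
bPosSum i (𝐚 ∷ w) = bPosSum (suc i) w
bPosSum i (𝐛 ∷ w) = i ℕ.+ bPosSum (suc i) w

Θword : List Letter → Poly
Θword w = qpow (bPosSum 1 w)

Θ : ABPoly → Poly
Θ []            = 0ₚ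
Θ ((c , w) ∷ t) = (c ·ₚ Θword w) +ₚ Θ t

-- Subsets S ⊆ {1,…,r-1} encoded as Bool lists of length r-1
-- (entry i-1 is true iff i ∈ S).

subsets : ℕ → List (List Bool)
subsets zero    = [] ∷ []
subsets (suc n) = map (true ∷_) (subsets n) ++ map (false ∷_) (subsets n)

vS : List Bool → ABPoly
vS []          = (+ 1 , []) ∷ []
vS (true ∷ s)  = ((+ 1 , 𝐛 ∷ []) ∷ []) ⊗ vS s
vS (false ∷ s) = ((+ 1 , 𝐚 ∷ []) ∷ (ℤ.- (+ 1) , 𝐛 ∷ []) ∷ []) ⊗ vS s

elems : ℕ → List Bool → List ℕ
elems i []          = []
elems i (true ∷ s)  = i ∷ elems (suc i) s
elems i (false ∷ s) = elems (suc i) s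

record RankedPoset : Set where
  field
    size : ℕ
    le   : Fin size → Fin size → Bool
    rk   : Fin size → ℕ
    bot  : Fin size
    top  : Fin size

  lt : Fin size → Fin size → Bool
  lt x y = le x y ∧ not ⌊ x Fin.≟ y ⌋

  _≤ᴾ_ _<ᴾ_ : Fin size → Fin size → Set
  x ≤ᴾ y = T (le x y)
  x <ᴾ y = T (lt x y)

  _⋖_ : Fin size → Fin size → Set
  x ⋖ y = x <ᴾ y × (∀ z → ¬ (x <ᴾ z × z <ᴾ y))

  rank : ℕ
  rank = rk top

open RankedPoset public

record IsGraded (R : RankedPoset) : Set where
  field
    refl≤    : ∀ x → _≤ᴾ_ R x x
    antisym≤ : ∀ x y → _≤ᴾ_ R x y → _≤ᴾ_ R y x → x ≡ y
    trans≤   : ∀ x y z → _≤ᴾ_ R x y → _≤ᴾ_ R y z → _≤ᴾ_ R x z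
    bot-min  : ∀ x → _≤ᴾ_ R (bot R) x
    top-max  : ∀ x → _≤ᴾ_ R x (top R)
    rk-bot   : rk R (bot R) ≡ 0
    rk-cover : ∀ x y → _⋖_ R x y → rk R y ≡ suc (rk R x)

sumFin : ∀ {n} → (Fin n → ℕ) → ℕ
sumFin {zero}  f = 0
sumFin {suc n} f = f Fin.zero ℕ.+ sumFin (λ i → f (Fin.suc i))

countChains : (R : RankedPoset) → Fin (size R) → List ℕ → ℕ
countChains R prev []       = 1
countChains R prev (s ∷ ss) =
  sumFin (λ x → if (rk R x ≡ᵇ s) ∧ lt R prev x ∧ lt R x (top R)
                then countChains R x ss else 0)

flagF : (R : RankedPoset) → List Bool → ℕ
flagF R S = countChains R (bot R) (elems 1 S)

Ψ : RankedPoset → ABPoly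
Ψ R = concatMap (λ S → scaleAB (+ flagF R S) (vS S)) (subsets (rank R ∸ 1))

-- Cartesian product with componentwise order and rank ρ_P + ρ_Q
-- (carrier Fin (|P| * |Q|) ≅ Fin |P| × Fin |Q| via combine/remQuot)

_×ᴾ_ : RankedPoset → RankedPoset → RankedPoset
P ×ᴾ Q = record
  { size = size P ℕ.* size Q
  ; le   = λ x y → le P (proj₁ (split x)) (proj₁ (split y))
                 ∧ le Q (proj₂ (split x)) (proj₂ (split y))
  ; rk   = λ x → rk P (proj₁ (split x)) ℕ.+ rk Q (proj₂ (split x))
  ; bot  = combine (bot P) (bot Q)
  ; top  = combine (top P) (top Q)
  }
  where
  split : Fin (size P ℕ.* size Q) → Fin (size P) × Fin (size Q)
  split = remQuot (size Q)

{-# OPTIONS --safe #-}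
module Submission where

-- Since Θ(v_S) = ∏_{i ∈ S} q^i ∏_{i ∉ S} (1 - q^i), dividing Θ(Ψ(R)) by (q; q)_r = (1 - q) ⋯ (1 - q^r)
-- turns Σ_S f_S v_S into 1/(1 - q^r) times the sum over the chains 0̂ < x₁ < ⋯ < x_k < 1̂ of
-- ∏ᵢ q^ρ(xᵢ)/(1 - q^ρ(xᵢ)), which is the generating function M_R(1̂) of the multichains
-- 0̂ < y₁ ≤ ⋯ ≤ y_t ≤ 1̂ weighted by q^(ρ y₁ + ⋯ + ρ y_t). These series are characterised by M(0̂) = 1 and
-- M(z) = Σ_{w ≤ z} q^ρ(w) M(w), because ρ(w) ≥ 1 for w ≠ 0̂. Lower intervals of P × Q are products and
-- the rank is additive, so M_P(x) M_Q(y) satisfies the recurrence of P × Q and M_{P×Q} = M_P M_Q. Hence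
-- (q; q)_m (q; q)_n Θ(Ψ(P × Q)) = (q; q)_{m+n} Θ(Ψ(P)) Θ(Ψ(Q)), and (q; q)_k = (1 - q)^k [k]! gives the
-- theorem after cancelling (1 - q)^(m+n). Gradedness is only used to know that the rank is strictly monotone.

open import Defs

open import Algebra.Bundles using (CommutativeRing; Semiring)
open import Algebra.Structures using (IsCommutativeRing)
open import Algebra.Solver.Ring.AlmostCommutativeRing using (_-Raw-AlmostCommutative⟶_; fromCommutativeRing)
import Algebra.Solver.Ring
open import Data.Bool using (Bool; true; false; if_then_else_; _∧_; T)
open import Data.Bool.Properties using (T-≡; T-∧; ⇔→≡; ∧-zeroʳ; ∧-identityʳ)
open import Data.Empty using (⊥-elim)
open import Data.Fin as Fin using (Fin)
import Data.Fin.Properties as Finₚ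
open import Data.Fin.Subset using (Subset; _∈_; _⊂_)
open import Data.Fin.Subset.Induction using (⊂-wellFounded)
open import Data.Integer using (ℤ; +_)
import Data.Integer as ℤ
import Data.Integer.Properties as ℤₚ
open import Data.List using (List; []; _∷_; _++_; concatMap)
import Data.List as List
open import Data.Maybe using (Maybe)
import Data.Maybe as Maybe
open import Data.Nat as ℕ using (ℕ; zero; suc; _∸_; _≡ᵇ_; z≤n; s≤s)
open import Data.Nat.Divisibility using (_∣?_; _∣0; n∣n; ∣m∣n⇒∣m+n; ∣m+n∣m⇒∣n; ∣⇒≤; 0∣⇒≡0)
open import Data.Nat.Induction using (<-rec)
import Data.Nat.Properties as ℕₚ
open import Data.Product using (_×_; _,_; proj₁; proj₂)
open import Data.Sum using (_⊎_; inj₁; inj₂)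
import Data.Vec as Vec
import Data.Vec.Properties as Vecₚ
open import Function using (_∘_)
open import Function.Bundles using (Equivalence; mk⇔)
open import Induction.WellFounded using (Acc; acc)
open import Level using (0ℓ)
open import Relation.Binary.Definitions using (tri<; tri≈; tri>)
open import Relation.Binary.PropositionalEquality
import Relation.Binary.Construct.On as On
import Relation.Binary.Reasoning.Setoid as SetoidReasoning
open import Relation.Nullary using (¬_; Dec; yes; no; does)
open import Relation.Nullary.Decidable using (⌊_⌋; T?; dec⇒maybe; dec-true; dec-false)

open Equivalence using (to; from)

T-does : ∀ {A : Set} (A? : Dec A) → A → T (does A?)
T-does A? a = from T-≡ (dec-true A? a)

T-injective : ∀ {a b} → (T a → T b) → (T b → T a) → a ≡ b
T-injective a→b b→a = ⇔→≡ {z = true} (mk⇔ (to T-≡ ∘ a→b ∘ from T-≡) (to T-≡ ∘ b→a ∘ from T-≡))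

module Coefficients where
  open import Data.Integer using (_+_; _*_; -_)
  open import Algebra.Properties.CommutativeSemigroup ℤₚ.+-commutativeSemigroup
    using (interchange)

  sumBelow-cong : ∀ n {f g : ℕ → ℤ} → (∀ {i} → i ℕ.< n → f i ≡ g i) →
                  sumBelow n f ≡ sumBelow n g
  sumBelow-cong zero    f≗g = refl
  sumBelow-cong (suc n) f≗g = cong₂ _+_ (sumBelow-cong n (f≗g ∘ ℕₚ.m<n⇒m<1+n)) (f≗g (ℕₚ.n<1+n n))

  sumBelow-zero : ∀ n {f : ℕ → ℤ} → (∀ {i} → i ℕ.< n → f i ≡ + 0) → sumBelow n f ≡ + 0
  sumBelow-zero zero    f≗0 = refl
  sumBelow-zero (suc n) f≗0 = cong₂ _+_ (sumBelow-zero n (f≗0 ∘ ℕₚ.m<n⇒m<1+n)) (f≗0 (ℕₚ.n<1+n n))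

  sumBelow-+ : ∀ n (f g : ℕ → ℤ) → sumBelow n (λ i → f i + g i) ≡ sumBelow n f + sumBelow n g
  sumBelow-+ zero    f g = refl
  sumBelow-+ (suc n) f g = begin
    sumBelow n (λ i → f i + g i) + (f n + g n)     ≡⟨ cong (_+ (f n + g n)) (sumBelow-+ n f g) ⟩
    (sumBelow n f + sumBelow n g) + (f n + g n)    ≡⟨ interchange (sumBelow n f) (sumBelow n g) (f n) (g n) ⟩
    (sumBelow n f + f n) + (sumBelow n g + g n)    ∎
    where open ≡-Reasoning

  sumBelow-*ˡ : ∀ n c (f : ℕ → ℤ) → c * sumBelow n f ≡ sumBelow n (λ i → c * f i)
  sumBelow-*ˡ zero    c f = ℤₚ.*-zeroʳ c
  sumBelow-*ˡ (suc n) c f =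
    trans (ℤₚ.*-distribˡ-+ c (sumBelow n f) (f n)) (cong (_+ c * f n) (sumBelow-*ˡ n c f))

  sumBelow-*ʳ : ∀ n c (f : ℕ → ℤ) → sumBelow n f * c ≡ sumBelow n (λ i → f i * c)
  sumBelow-*ʳ n c f = begin
    sumBelow n f * c                 ≡⟨ ℤₚ.*-comm (sumBelow n f) c ⟩
    c * sumBelow n f                 ≡⟨ sumBelow-*ˡ n c f ⟩
    sumBelow n (λ i → c * f i)       ≡⟨ sumBelow-cong n (λ {i} _ → ℤₚ.*-comm c (f i)) ⟩
    sumBelow n (λ i → f i * c)       ∎
    where open ≡-Reasoning

  sumBelow-head : ∀ n (f : ℕ → ℤ) → sumBelow (suc n) f ≡ f 0 + sumBelow n (f ∘ suc)
  sumBelow-head zero    f = trans (ℤₚ.+-identityˡ (f 0)) (sym (ℤₚ.+-identityʳ (f 0)))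
  sumBelow-head (suc n) f =
    trans (cong (_+ f (suc n)) (sumBelow-head n f)) (ℤₚ.+-assoc (f 0) _ _)

  sumBelow-reverse : ∀ n (f : ℕ → ℤ) → sumBelow n f ≡ sumBelow n (λ i → f (n ∸ suc i))
  sumBelow-reverse zero    f = refl
  sumBelow-reverse (suc n) f = begin
    sumBelow n f + f n                                ≡⟨ ℤₚ.+-comm _ (f n) ⟩
    f n + sumBelow n f                                ≡⟨ cong (λ s → f n + s) (sumBelow-reverse n f) ⟩
    f n + sumBelow n (λ i → f (n ∸ suc i))            ≡⟨ sumBelow-head n (λ i → f (n ∸ i)) ⟨
    sumBelow (suc n) (λ i → f (n ∸ i))                ∎
    where open ≡-Reasoning

  sumBelow-triangle : ∀ n (F : ℕ → ℕ → ℤ) →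
    sumBelow n (λ i → sumBelow (suc i) (F i)) ≡ sumBelow n (λ j → sumBelow (n ∸ j) (λ l → F (j ℕ.+ l) j))
  sumBelow-triangle zero    F = refl
  sumBelow-triangle (suc n) F = begin
    sumBelow n (λ i → sumBelow (suc i) (F i)) + sumBelow (suc n) (F n)
      ≡⟨ cong (_+ sumBelow (suc n) (F n)) (sumBelow-triangle n F) ⟩
    sumBelow n column + sumBelow (suc n) (F n)
      ≡⟨ cong (_+ sumBelow (suc n) (F n)) lastColumn ⟨
    sumBelow (suc n) column + sumBelow (suc n) (F n)
      ≡⟨ sumBelow-+ (suc n) column (F n) ⟨
    sumBelow (suc n) (λ j → column j + F n j)
      ≡⟨ sumBelow-cong (suc n) (λ j≤n → sym (extendColumn (ℕₚ.≤-pred j≤n))) ⟩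
    sumBelow (suc n) (λ j → sumBelow (suc n ∸ j) (λ l → F (j ℕ.+ l) j))
      ∎
    where
    open ≡-Reasoning
    column : ℕ → ℤ
    column j = sumBelow (n ∸ j) (λ l → F (j ℕ.+ l) j)
    lastColumn : sumBelow (suc n) column ≡ sumBelow n column
    lastColumn rewrite ℕₚ.n∸n≡0 n = ℤₚ.+-identityʳ (sumBelow n column)
    extendColumn : ∀ {j} → j ℕ.≤ n → sumBelow (suc n ∸ j) (λ l → F (j ℕ.+ l) j) ≡ column j + F n j
    extendColumn {j} j≤n rewrite ℕₚ.+-∸-assoc 1 j≤n = cong (λ i → column j + F i j) (ℕₚ.m+[n∸m]≡n j≤n)

  infix 8 -ₚ_
  -ₚ_ : Poly → Poly
  (-ₚ f) k = - f k

  const : ℤ → Poly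
  const c k = if 0 ≡ᵇ k then c else + 0

  const-*ₚ : ∀ c f k → (const c *ₚ f) k ≡ c * f k
  const-*ₚ c f k = begin
    sumBelow (suc k) (λ i → const c i * f (k ∸ i))        ≡⟨ sumBelow-head k _ ⟩
    c * f k + sumBelow k (λ i → + 0 * f (k ∸ suc i))
      ≡⟨ cong (λ s → c * f k + s) (sumBelow-zero k (λ _ → refl)) ⟩
    c * f k + + 0                                          ≡⟨ ℤₚ.+-identityʳ _ ⟩
    c * f k                                                ∎
    where open ≡-Reasoning

  *ₚ-identityˡ : ∀ f → 1ₚ *ₚ f ≈ₚ f
  *ₚ-identityˡ f k = trans (const-*ₚ (+ 1) f k) (ℤₚ.*-identityˡ (f k))

  *ₚ-comm : ∀ f g → f *ₚ g ≈ₚ g *ₚ f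
  *ₚ-comm f g k = begin
    sumBelow (suc k) (λ i → f i * g (k ∸ i))                 ≡⟨ sumBelow-reverse (suc k) _ ⟩
    sumBelow (suc k) (λ i → f (k ∸ i) * g (k ∸ (k ∸ i)))     ≡⟨ sumBelow-cong (suc k) swap ⟩
    sumBelow (suc k) (λ i → g i * f (k ∸ i))                 ∎
    where
    open ≡-Reasoning
    swap : ∀ {i} → i ℕ.< suc k → f (k ∸ i) * g (k ∸ (k ∸ i)) ≡ g i * f (k ∸ i)
    swap {i} i<1+k rewrite ℕₚ.m∸[m∸n]≡n (ℕₚ.≤-pred i<1+k) = ℤₚ.*-comm (f (k ∸ i)) (g i)

  *ₚ-assoc : ∀ f g h → (f *ₚ g) *ₚ h ≈ₚ f *ₚ (g *ₚ h)
  *ₚ-assoc f g h k = begin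
    sumBelow (suc k) (λ i → sumBelow (suc i) (λ j → f j * g (i ∸ j)) * h (k ∸ i))
      ≡⟨ sumBelow-cong (suc k) (λ {i} _ → sumBelow-*ʳ (suc i) (h (k ∸ i)) _) ⟩
    sumBelow (suc k) (λ i → sumBelow (suc i) (λ j → f j * g (i ∸ j) * h (k ∸ i)))
      ≡⟨ sumBelow-triangle (suc k) (λ i j → f j * g (i ∸ j) * h (k ∸ i)) ⟩
    sumBelow (suc k) (λ j → sumBelow (suc k ∸ j) (λ l → f j * g (j ℕ.+ l ∸ j) * h (k ∸ (j ℕ.+ l))))
      ≡⟨ sumBelow-cong (suc k) (λ {j} j<1+k → row j (ℕₚ.≤-pred j<1+k)) ⟩
    sumBelow (suc k) (λ j → f j * sumBelow (suc (k ∸ j)) (λ l → g l * h (k ∸ j ∸ l)))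
      ∎
    where
    open ≡-Reasoning
    row : ∀ j → j ℕ.≤ k →
          sumBelow (suc k ∸ j) (λ l → f j * g (j ℕ.+ l ∸ j) * h (k ∸ (j ℕ.+ l)))
          ≡ f j * sumBelow (suc (k ∸ j)) (λ l → g l * h (k ∸ j ∸ l))
    row j j≤k rewrite ℕₚ.+-∸-assoc 1 j≤k = begin
      sumBelow (suc (k ∸ j)) (λ l → f j * g (j ℕ.+ l ∸ j) * h (k ∸ (j ℕ.+ l)))
        ≡⟨ sumBelow-cong (suc (k ∸ j)) (λ {l} _ → reassociate l) ⟩
      sumBelow (suc (k ∸ j)) (λ l → f j * (g l * h (k ∸ j ∸ l)))
        ≡⟨ sumBelow-*ˡ (suc (k ∸ j)) (f j) _ ⟨
      f j * sumBelow (suc (k ∸ j)) (λ l → g l * h (k ∸ j ∸ l))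
        ∎
      where
      reassociate : ∀ l → f j * g (j ℕ.+ l ∸ j) * h (k ∸ (j ℕ.+ l)) ≡ f j * (g l * h (k ∸ j ∸ l))
      reassociate l rewrite ℕₚ.m+n∸m≡n j l | ℕₚ.∸-+-assoc k j l = ℤₚ.*-assoc (f j) (g l) _

  *ₚ-distribˡ : ∀ f g h → f *ₚ (g +ₚ h) ≈ₚ f *ₚ g +ₚ f *ₚ h
  *ₚ-distribˡ f g h k =
    trans (sumBelow-cong (suc k) (λ {i} _ → ℤₚ.*-distribˡ-+ (f i) (g (k ∸ i)) (h (k ∸ i))))
          (sumBelow-+ (suc k) _ _)

  *ₚ-cong : ∀ {f f′ g g′} → f ≈ₚ f′ → g ≈ₚ g′ → f *ₚ g ≈ₚ f′ *ₚ g′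
  *ₚ-cong f≈f′ g≈g′ k = sumBelow-cong (suc k) (λ {i} _ → cong₂ _*_ (f≈f′ i) (g≈g′ (k ∸ i)))

  qpow-suc-*ₚ : ∀ a f k → (qpow (suc a) *ₚ f) (suc k) ≡ (qpow a *ₚ f) k
  qpow-suc-*ₚ a f k = trans (sumBelow-head (suc k) _) (ℤₚ.+-identityˡ _)

  qpow-*ₚ-below : ∀ {a k} f → k ℕ.< a → (qpow a *ₚ f) k ≡ + 0
  qpow-*ₚ-below {suc a} {zero}  f _         = refl
  qpow-*ₚ-below {suc a} {suc k} f (s≤s k<a) = trans (qpow-suc-*ₚ a f k) (qpow-*ₚ-below f k<a)

  qpow-*ₚ-shift : ∀ a f k → (qpow a *ₚ f) (a ℕ.+ k) ≡ f k
  qpow-*ₚ-shift zero    f k = *ₚ-identityˡ f k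
  qpow-*ₚ-shift (suc a) f k = trans (qpow-suc-*ₚ a f (a ℕ.+ k)) (qpow-*ₚ-shift a f k)

  qpow-+-*ₚ : ∀ a b → qpow (a ℕ.+ b) ≈ₚ qpow a *ₚ qpow b
  qpow-+-*ₚ zero    b k       = sym (*ₚ-identityˡ (qpow b) k)
  qpow-+-*ₚ (suc a) b zero    = refl
  qpow-+-*ₚ (suc a) b (suc k) = trans (qpow-+-*ₚ a b k) (sym (qpow-suc-*ₚ a (qpow b) k))

  data Position (a : ℕ) : ℕ → Set where
    below : ∀ {k} → k ℕ.< a → Position a k
    above : ∀ i → Position a (a ℕ.+ i)

  position : ∀ a k → Position a k
  position zero    k       = above k
  position (suc a) zero    = below (s≤s z≤n)
  position (suc a) (suc k) with position a k
  ... | below k<a = below (s≤s k<a)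
  ... | above i   = above i

module Series where
  open Coefficients

  -- A record rather than _≈ₚ_ itself, so that f and g are determined by the type of a proof.
  infix 4 _≈_
  record _≈_ (f g : Poly) : Set where
    constructor mk≈
    field coeff : f ≈ₚ g
  open _≈_ public

  -- Opaque, so that unification never unfolds the ring operations into coefficient formulas.
  opaque
    infixl 6 _+_
    infixl 7 _*_
    infix  8 -_
    _+_ _*_ : Poly → Poly → Poly
    _+_ = _+ₚ_
    _*_ = _*ₚ_
    -_ : Poly → Poly
    -_ = -ₚ_

  opaque
    unfolding _+_ _*_ -_

    +≡+ₚ : ∀ f g → f + g ≡ f +ₚ g
    +≡+ₚ f g = refl

    *≡*ₚ : ∀ f g → f * g ≡ f *ₚ g
    *≡*ₚ f g = refl

    -‿coeff : ∀ f k → (- f) k ≡ ℤ.- f k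
    -‿coeff f k = refl

    +-*-isCommutativeRing : IsCommutativeRing _≈_ _+_ _*_ -_ 0ₚ 1ₚ
    +-*-isCommutativeRing = record
        { isRing = record
          { +-isAbelianGroup = record
            { isGroup = record
              { isMonoid = record
                { isSemigroup = record
                  { isMagma = record
                    { isEquivalence = record
                      { refl  = mk≈ λ _ → refl
                      ; sym   = λ f≈g → mk≈ λ k → sym (coeff f≈g k)
                      ; trans = λ f≈g g≈h → mk≈ λ k → trans (coeff f≈g k) (coeff g≈h k) }
                    ; ∙-cong = λ f≈g h≈i → mk≈ λ k → cong₂ ℤ._+_ (coeff f≈g k) (coeff h≈i k) }
                  ; assoc = λ f g h → mk≈ λ k → ℤₚ.+-assoc (f k) (g k) (h k) }
                ; identity = (λ f → mk≈ λ k → ℤₚ.+-identityˡ (f k))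
                           , (λ f → mk≈ λ k → ℤₚ.+-identityʳ (f k)) }
              ; inverse = (λ f → mk≈ λ k → ℤₚ.+-inverseˡ (f k))
                        , (λ f → mk≈ λ k → ℤₚ.+-inverseʳ (f k))
              ; ⁻¹-cong = λ f≈g → mk≈ λ k → cong ℤ.-_ (coeff f≈g k) }
            ; comm = λ f g → mk≈ λ k → ℤₚ.+-comm (f k) (g k) }
          ; *-cong     = λ f≈g h≈i → mk≈ (*ₚ-cong (coeff f≈g) (coeff h≈i))
          ; *-assoc    = λ f g h → mk≈ (*ₚ-assoc f g h)
          ; *-identity = (λ f → mk≈ (*ₚ-identityˡ f))
                       , (λ f → mk≈ λ k → trans (*ₚ-comm f 1ₚ k) (*ₚ-identityˡ f k))
          ; distrib    = (λ f g h → mk≈ (*ₚ-distribˡ f g h))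
                       , (λ f g h → mk≈ λ k → trans (*ₚ-comm (g +ₚ h) f k) (trans (*ₚ-distribˡ f g h k)
                                                 (cong₂ ℤ._+_ (*ₚ-comm f g k) (*ₚ-comm f h k)))) }
        ; *-comm = λ f g → mk≈ (*ₚ-comm f g) }

  PolyRing : CommutativeRing 0ℓ 0ℓ
  PolyRing = record { isCommutativeRing = +-*-isCommutativeRing }

  open CommutativeRing PolyRing public
    using ( +-cong; +-congˡ; +-congʳ; +-assoc; +-comm; +-identityˡ; +-identityʳ; -‿cong
          ; *-cong; *-congˡ; *-congʳ; *-assoc; *-comm; *-identityˡ; *-identityʳ
          ; distribˡ; zeroˡ; zeroʳ; -‿inverseʳ )
    renaming (refl to ≈-refl; sym to ≈-sym; trans to ≈-trans; reflexive to ≈-reflexive)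

  open import Algebra.Definitions.RawSemiring (Semiring.rawSemiring (CommutativeRing.semiring PolyRing)) public
    using (_^_)

  module ≈-Reasoning = SetoidReasoning (CommutativeRing.setoid PolyRing)

  +-coeff : ∀ f g k → (f + g) k ≡ f k ℤ.+ g k
  +-coeff f g k = cong (λ h → h k) (+≡+ₚ f g)

  *-coeff : ∀ f g k → (f * g) k ≡ (f *ₚ g) k
  *-coeff f g k = cong (λ h → h k) (*≡*ₚ f g)

  const-0 : const (+ 0) ≈ 0ₚ
  const-0 = mk≈ λ { zero → refl ; (suc k) → refl }

  const-+ : ∀ c d → const (c ℤ.+ d) ≈ const c + const d
  const-+ c d = mk≈ λ k → trans (coefficient k) (sym (+-coeff (const c) (const d) k))
    where
    coefficient : ∀ k → const (c ℤ.+ d) k ≡ const c k ℤ.+ const d k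
    coefficient zero    = refl
    coefficient (suc k) = refl

  const-* : ∀ c d → const (c ℤ.* d) ≈ const c * const d
  const-* c d = mk≈ λ k → sym (trans (*-coeff (const c) (const d) k) (trans (const-*ₚ c (const d) k) (coefficient k)))
    where
    coefficient : ∀ k → c ℤ.* const d k ≡ const (c ℤ.* d) k
    coefficient zero    = refl
    coefficient (suc k) = ℤₚ.*-zeroʳ c

  const-neg : ∀ c → const (ℤ.- c) ≈ - const c
  const-neg c = mk≈ λ k → trans (coefficient k) (sym (-‿coeff (const c) k))
    where
    coefficient : ∀ k → const (ℤ.- c) k ≡ ℤ.- const c k
    coefficient zero    = refl
    coefficient (suc k) = refl

  const-homomorphism : CommutativeRing.rawRing ℤₚ.+-*-commutativeRing
                       -Raw-AlmostCommutative⟶ fromCommutativeRing PolyRing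
  const-homomorphism = record
    { ⟦_⟧ = const ; +-homo = const-+ ; *-homo = const-* ; -‿homo = const-neg ; 0-homo = const-0 ; 1-homo = ≈-refl }

  const-≟ : ∀ c d → Maybe (const c ≈ const d)
  const-≟ c d = Maybe.map (≈-reflexive ∘ cong const) (dec⇒maybe (c ℤₚ.≟ d))

  module PolySolver = Algebra.Solver.Ring
    (CommutativeRing.rawRing ℤₚ.+-*-commutativeRing) (fromCommutativeRing PolyRing) const-homomorphism const-≟

  qpow-*-below : ∀ {a k} f → k ℕ.< a → (qpow a * f) k ≡ + 0
  qpow-*-below {a} {k} f k<a = trans (*-coeff (qpow a) f k) (qpow-*ₚ-below f k<a)

  qpow-*-shift : ∀ a f k → (qpow a * f) (a ℕ.+ k) ≡ f k
  qpow-*-shift a f k = trans (*-coeff (qpow a) f (a ℕ.+ k)) (qpow-*ₚ-shift a f k)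

  qpow-*-coeff-cong : ∀ {r} f g k → 0 ℕ.< r → (∀ {j} → j ℕ.< k → f j ≡ g j) →
                      (qpow r * f) k ≡ (qpow r * g) k
  qpow-*-coeff-cong {r} f g k 0<r f≗g with position r k
  ... | below k<r = trans (qpow-*-below f k<r) (sym (qpow-*-below g k<r))
  ... | above i   = trans (qpow-*-shift r f i) (trans (f≗g (ℕₚ.m<n+m i 0<r)) (sym (qpow-*-shift r g i)))

  qpow-+ : ∀ a b → qpow (a ℕ.+ b) ≈ qpow a * qpow b
  qpow-+ a b = mk≈ λ k → trans (qpow-+-*ₚ a b k) (sym (*-coeff (qpow a) (qpow b) k))

  infix 8 1-q^_
  1-q^_ : ℕ → Poly
  1-q^ a = 1ₚ + - qpow a

  bit : Bool → ℤ
  bit b = if b then + 1 else + 0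

  -- Σ_j q^(a j), that is 1/(1 - q^a) for a ≥ 1. Since 0 ∣ k only for k = 0, geometric 0 is 1ₚ.
  geometric : ℕ → Poly
  geometric a k = bit (does (a ∣? k))

  geometric-zero : geometric 0 ≈ 1ₚ
  geometric-zero = mk≈ λ
    { zero    → refl
    ; (suc k) → cong bit (dec-false (0 ∣? suc k) (ℕₚ.1+n≢0 ∘ 0∣⇒≡0)) }

  1-q^-*-geometric : ∀ {a} → 0 ℕ.< a → 1-q^ a * geometric a ≈ 1ₚ
  1-q^-*-geometric {a} 0<a = ≈-trans (expand (qpow a) (geometric a)) (mk≈ coefficient)
    where
    open PolySolver
    expand : ∀ x g → (1ₚ + - x) * g ≈ g + - (x * g)
    expand = solve 2 (λ x g → (con (+ 1) :- x) :* g := g :- x :* g) ≈-refl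
    shift : ∀ i → geometric a (a ℕ.+ i) ≡ geometric a i
    shift i with a ∣? i
    ... | yes a∣i = cong bit (dec-true (a ∣? (a ℕ.+ i)) (∣m∣n⇒∣m+n n∣n a∣i))
    ... | no ¬a∣i = cong bit (dec-false (a ∣? (a ℕ.+ i)) λ a∣a+i → ¬a∣i (∣m+n∣m⇒∣n a∣a+i n∣n))
    initial : ∀ {k} → k ℕ.< a → geometric a k ≡ 1ₚ k
    initial {zero}  _     = cong bit (dec-true (a ∣? 0) (a ∣0))
    initial {suc k} 1+k<a = cong bit (dec-false (a ∣? suc k) (ℕₚ.<⇒≱ 1+k<a ∘ ∣⇒≤))
    1ₚ-vanishes : ∀ {b} i → 0 ℕ.< b → 1ₚ (b ℕ.+ i) ≡ + 0
    1ₚ-vanishes {suc b} i _ = refl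
    coefficient : ∀ k → (geometric a + - (qpow a * geometric a)) k ≡ 1ₚ k
    coefficient k rewrite +-coeff (geometric a) (- (qpow a * geometric a)) k | -‿coeff (qpow a * geometric a) k
      with position a k
    ... | below k<a rewrite qpow-*-below (geometric a) k<a = trans (ℤₚ.+-identityʳ _) (initial k<a)
    ... | above i rewrite qpow-*-shift a (geometric a) i | shift i =
      trans (ℤₚ.+-inverseʳ (geometric a i)) (sym (1ₚ-vanishes i 0<a))

  geometric-unfold : ∀ {a} → 0 ℕ.< a → ∀ f → geometric a * f ≈ f + qpow a * (geometric a * f)
  geometric-unfold {a} 0<a f = begin
    geometric a * f                                        ≈⟨ split (geometric a) (qpow a) f ⟩
    1-q^ a * geometric a * f + qpow a * (geometric a * f)  ≈⟨ +-congʳ (*-congʳ (1-q^-*-geometric 0<a)) ⟩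
    1ₚ * f + qpow a * (geometric a * f)                    ≈⟨ +-congʳ (*-identityˡ f) ⟩
    f + qpow a * (geometric a * f)                         ∎
    where
    open ≈-Reasoning
    open PolySolver
    split : ∀ g x f → g * f ≈ (1ₚ + - x) * g * f + x * (g * f)
    split = solve 3 (λ g x f → g :* f := (con (+ 1) :- x) :* g :* f :+ x :* (g :* f)) ≈-refl

  pochhammer : ℕ → ℕ → Poly
  pochhammer a zero    = 1ₚ
  pochhammer a (suc n) = 1-q^ a * pochhammer (suc a) n

  pochhammer-snoc : ∀ a n → pochhammer a (suc n) ≈ pochhammer a n * 1-q^ (a ℕ.+ n)
  pochhammer-snoc a zero    rewrite ℕₚ.+-identityʳ a = *-comm (1-q^ a) 1ₚ
  pochhammer-snoc a (suc n) rewrite ℕₚ.+-suc a n =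
    ≈-trans (*-congˡ (pochhammer-snoc (suc a) n)) (≈-sym (*-assoc (1-q^ a) _ _))

  qint-does : ∀ k j → qint k j ≡ bit (does (j ℕₚ.<? k))
  qint-does k j = cong bit (isYes≡does (j ℕₚ.<? k))
    where
    isYes≡does : ∀ {A : Set} (A? : Dec A) → ⌊ A? ⌋ ≡ does A?
    isYes≡does (yes _) = refl
    isYes≡does (no _)  = refl

  qint-suc : ∀ k → qint (suc k) ≈ 1ₚ + qpow 1 * qint k
  qint-suc k = mk≈ λ j → trans (coefficient j) (sym (+-coeff 1ₚ (qpow 1 * qint k) j))
    where
    open ≡-Reasoning
    coefficient : ∀ j → qint (suc k) j ≡ 1ₚ j ℤ.+ (qpow 1 * qint k) j
    coefficient zero    = trans (qint-does (suc k) 0) (sym (cong (ℤ._+_ (+ 1)) (qpow-*-below (qint k) (s≤s z≤n))))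
    coefficient (suc j) = begin
      qint (suc k) (suc j)                      ≡⟨ qint-does (suc k) (suc j) ⟩
      bit (does (j ℕₚ.<? k))                    ≡⟨ qint-does k j ⟨
      qint k j                                  ≡⟨ qpow-*-shift 1 (qint k) j ⟨
      (qpow 1 * qint k) (suc j)                 ≡⟨ ℤₚ.+-identityˡ _ ⟨
      + 0 ℤ.+ (qpow 1 * qint k) (suc j)         ∎

  1-q^1-*-qint : ∀ k → 1-q^ 1 * qint k ≈ 1-q^ k
  1-q^1-*-qint zero    = begin
    1-q^ 1 * qint 0    ≈⟨ *-congˡ (mk≈ (qint-does 0)) ⟩
    1-q^ 1 * 0ₚ        ≈⟨ zeroʳ (1-q^ 1) ⟩
    0ₚ                 ≈⟨ -‿inverseʳ 1ₚ ⟨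
    1-q^ 0             ∎
    where open ≈-Reasoning
  1-q^1-*-qint (suc k) = begin
    1-q^ 1 * qint (suc k)                     ≈⟨ *-congˡ (qint-suc k) ⟩
    1-q^ 1 * (1ₚ + qpow 1 * qint k)           ≈⟨ expand (qpow 1) (qint k) ⟩
    1-q^ 1 + qpow 1 * (1-q^ 1 * qint k)       ≈⟨ +-congˡ (*-congˡ (1-q^1-*-qint k)) ⟩
    1-q^ 1 + qpow 1 * 1-q^ k                  ≈⟨ telescope (qpow 1) (qpow k) ⟩
    1ₚ + - (qpow 1 * qpow k)                  ≈⟨ +-congˡ (-‿cong (qpow-+ 1 k)) ⟨
    1-q^ (suc k)                              ∎
    where
    open ≈-Reasoning
    open PolySolver
    expand : ∀ q i → (1ₚ + - q) * (1ₚ + q * i) ≈ (1ₚ + - q) + q * ((1ₚ + - q) * i)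
    expand = solve 2 (λ q i → (con (+ 1) :- q) :* (con (+ 1) :+ q :* i)
                              := (con (+ 1) :- q) :+ q :* ((con (+ 1) :- q) :* i)) ≈-refl
    telescope : ∀ q p → (1ₚ + - q) + q * (1ₚ + - p) ≈ 1ₚ + - (q * p)
    telescope = solve 2 (λ q p → (con (+ 1) :- q) :+ q :* (con (+ 1) :- p) := con (+ 1) :- q :* p) ≈-refl

  pochhammer-qfact : ∀ k → pochhammer 1 k ≈ (1-q^ 1) ^ k * qfact k
  pochhammer-qfact zero    = ≈-sym (*-identityˡ 1ₚ)
  pochhammer-qfact (suc k) = begin
    pochhammer 1 (suc k)                          ≈⟨ pochhammer-snoc 1 k ⟩
    pochhammer 1 k * 1-q^ (suc k)                 ≈⟨ *-cong (≈-sym (pochhammer-qfact k)) (1-q^1-*-qint (suc k)) ⟨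
    (1-q^ 1) ^ k * qfact k * (1-q^ 1 * qint (suc k))
      ≈⟨ rearrange (1-q^ 1) ((1-q^ 1) ^ k) (qfact k) (qint (suc k)) ⟩
    (1-q^ 1 * (1-q^ 1) ^ k) * (qint (suc k) * qfact k)
      ≈⟨ *-congˡ (≈-reflexive (*≡*ₚ (qint (suc k)) (qfact k))) ⟩
    (1-q^ 1) ^ suc k * qfact (suc k)              ∎
    where
    open ≈-Reasoning
    open PolySolver
    rearrange : ∀ u v f i → v * f * (u * i) ≈ (u * v) * (i * f)
    rearrange = solve 4 (λ u v f i → v :* f :* (u :* i) := (u :* v) :* (i :* f)) ≈-refl

  *-cancelˡ : ∀ {u v f g} → v * u ≈ 1ₚ → u * f ≈ u * g → f ≈ g
  *-cancelˡ {u} {v} {f} {g} vu≈1 uf≈ug = begin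
    f              ≈⟨ *-identityˡ f ⟨
    1ₚ * f         ≈⟨ *-congʳ vu≈1 ⟨
    v * u * f      ≈⟨ *-assoc v u f ⟩
    v * (u * f)    ≈⟨ *-congˡ uf≈ug ⟩
    v * (u * g)    ≈⟨ *-assoc v u g ⟨
    v * u * g      ≈⟨ *-congʳ vu≈1 ⟩
    1ₚ * g         ≈⟨ *-identityˡ g ⟩
    g              ∎
    where open ≈-Reasoning

  [1-q]^-*-cancelˡ : ∀ k {f g} → (1-q^ 1) ^ k * f ≈ (1-q^ 1) ^ k * g → f ≈ g
  [1-q]^-*-cancelˡ zero    = *-cancelˡ (*-identityˡ 1ₚ)
  [1-q]^-*-cancelˡ (suc k) {f} {g} uf≈ug = [1-q]^-*-cancelˡ k (*-cancelˡ inverse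
    (≈-trans (≈-sym (*-assoc (1-q^ 1) _ f)) (≈-trans uf≈ug (*-assoc (1-q^ 1) _ g))))
    where
    inverse : geometric 1 * 1-q^ 1 ≈ 1ₚ
    inverse = ≈-trans (*-comm _ _) (1-q^-*-geometric (s≤s z≤n))

module FiniteSums where
  open Series
  open import Algebra.Properties.Semiring.Sum (CommutativeRing.semiring PolyRing) public
    using (sum; sum-syntax; sum-cong-≋; ∑-distrib-+; ∑-comm; *-distribˡ-sum; *-distribʳ-sum; sum-replicate-zero)

  ∑-coeff-cong : ∀ {n} (f g : Fin n → Poly) k → (∀ x → f x k ≡ g x k) → sum f k ≡ sum g k
  ∑-coeff-cong {zero}  f g k f≗g = refl
  ∑-coeff-cong {suc n} f g k f≗g = begin
    (f Fin.zero + sum (f ∘ Fin.suc)) k                ≡⟨ +-coeff (f Fin.zero) _ k ⟩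
    f Fin.zero k ℤ.+ sum (f ∘ Fin.suc) k
      ≡⟨ cong₂ ℤ._+_ (f≗g Fin.zero) (∑-coeff-cong (f ∘ Fin.suc) (g ∘ Fin.suc) k (f≗g ∘ Fin.suc)) ⟩
    g Fin.zero k ℤ.+ sum (g ∘ Fin.suc) k              ≡⟨ +-coeff (g Fin.zero) _ k ⟨
    (g Fin.zero + sum (g ∘ Fin.suc)) k                ∎
    where open ≡-Reasoning

  ∑-↑ : ∀ m {n} (f : Fin (m ℕ.+ n) → Poly) →
        ∑[ i < m ℕ.+ n ] f i ≈ ∑[ i < m ] f (i Fin.↑ˡ n) + ∑[ j < n ] f (m Fin.↑ʳ j)
  ∑-↑ zero    f = ≈-sym (+-identityˡ _)
  ∑-↑ (suc m) f = ≈-trans (+-congˡ (∑-↑ m (f ∘ Fin.suc))) (≈-sym (+-assoc _ _ _))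

  ∑-combine : ∀ m n (f : Fin (m ℕ.* n) → Poly) →
              ∑[ z < m ℕ.* n ] f z ≈ ∑[ a < m ] ∑[ b < n ] f (Fin.combine a b)
  ∑-combine zero    n f = ≈-refl
  ∑-combine (suc m) n f = ≈-trans (∑-↑ n f) (+-congˡ (∑-combine m n (λ z → f (n Fin.↑ʳ z))))

  ∑-zero : ∀ {n} (f : Fin n → Poly) → (∀ x → f x ≈ 0ₚ) → sum f ≈ 0ₚ
  ∑-zero {n} f f≈0 = ≈-trans (sum-cong-≋ f≈0) (sum-replicate-zero n)

  when : Bool → Poly → Poly
  when b f = if b then f else 0ₚ

  when-cong : ∀ b {f g} → f ≈ g → when b f ≈ when b g
  when-cong true  f≈g = f≈g
  when-cong false f≈g = ≈-refl

  when-*ˡ : ∀ b f g → when b f * g ≈ when b (f * g)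
  when-*ˡ true  f g = ≈-refl
  when-*ˡ false f g = zeroˡ g

  when-*ʳ : ∀ b f g → f * when b g ≈ when b (f * g)
  when-*ʳ true  f g = ≈-refl
  when-*ʳ false f g = zeroʳ f

  ∑-when-≡ : ∀ {n} (z : Fin n) (f : Fin n → Poly) → ∑[ w < n ] when (does (w Fin.≟ z)) (f w) ≈ f z
  ∑-when-≡ {suc n} Fin.zero    f =
    ≈-trans (+-congˡ (∑-zero (λ w → when (does (Fin.suc w Fin.≟ Fin.zero)) (f (Fin.suc w))) (λ _ → ≈-refl)))
            (+-identityʳ (f Fin.zero))
  ∑-when-≡ {suc n} (Fin.suc z) f = ≈-trans (+-identityˡ _) (∑-when-≡ z (f ∘ Fin.suc))

  *-∑-when : ∀ {n} c (b : Fin n → Bool) (f : Fin n → Poly) →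
             c * ∑[ x < n ] when (b x) (f x) ≈ ∑[ x < n ] when (b x) (c * f x)
  *-∑-when {n} c b f =
    ≈-trans (*-distribˡ-sum c (λ x → when (b x) (f x))) (sum-cong-≋ {n} (λ x → when-*ʳ (b x) c (f x)))

  ∑-when-*-+ : ∀ {n} (b : Fin n → Bool) u (f g : Fin n → Poly) →
    ∑[ x < n ] when (b x) (u * (f x + g x)) ≈ ∑[ x < n ] when (b x) (u * f x) + ∑[ x < n ] when (b x) (u * g x)
  ∑-when-*-+ {n} b u f g =
    ≈-trans (sum-cong-≋ {n} (λ x → split (b x))) (∑-distrib-+ (λ x → when (b x) (u * f x)) _)
    where
    split : ∀ c {x} → when c (u * (f x + g x)) ≈ when c (u * f x) + when c (u * g x)
    split true  = distribˡ u _ _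
    split false = ≈-sym (+-identityˡ 0ₚ)

  private
    ∑-when-nested : ∀ {m n} (b : Fin m → Bool) (c : Fin m → Fin n → Bool) u v (F : Fin m → Fin n → Poly) →
      ∑[ x < m ] when (b x) (u * ∑[ w < n ] when (c x w) (v * F x w))
      ≈ ∑[ x < m ] ∑[ w < n ] when (b x ∧ c x w) (u * v * F x w)
    ∑-when-nested {m} {n} b c u v F = sum-cong-≋ {m} λ x → pull (b x) (c x) (F x)
      where
      pull : ∀ bx (cx : Fin n → Bool) (Fx : Fin n → Poly) →
             when bx (u * ∑[ w < n ] when (cx w) (v * Fx w)) ≈ ∑[ w < n ] when (bx ∧ cx w) (u * v * Fx w)
      pull false cx Fx = ≈-sym (∑-zero {n} (λ _ → 0ₚ) (λ _ → ≈-refl))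
      pull true  cx Fx = ≈-trans (*-distribˡ-sum u (λ w → when (cx w) (v * Fx w)))
        (sum-cong-≋ {n} λ w → ≈-trans (when-*ʳ (cx w) u _) (when-cong (cx w) (≈-sym (*-assoc u v (Fx w)))))

  ∑-when-nested-comm : ∀ {m n} (b : Fin m → Bool) (c : Fin m → Fin n → Bool)
    (b′ : Fin n → Bool) (c′ : Fin n → Fin m → Bool) u v (F : Fin m → Fin n → Poly) →
    (∀ x w → b x ∧ c x w ≡ b′ w ∧ c′ w x) →
    ∑[ x < m ] when (b x) (u * ∑[ w < n ] when (c x w) (v * F x w))
    ≈ ∑[ w < n ] when (b′ w) (v * ∑[ x < m ] when (c′ w x) (u * F x w))
  ∑-when-nested-comm {m} {n} b c b′ c′ u v F same = begin
    ∑[ x < m ] when (b x) (u * ∑[ w < n ] when (c x w) (v * F x w))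
      ≈⟨ ∑-when-nested b c u v F ⟩
    ∑[ x < m ] ∑[ w < n ] when (b x ∧ c x w) (u * v * F x w)
      ≈⟨ sum-cong-≋ {m} (λ x → sum-cong-≋ {n} λ w → reorder x w) ⟩
    ∑[ x < m ] ∑[ w < n ] when (b′ w ∧ c′ w x) (v * u * F x w)
      ≈⟨ ∑-comm (λ x w → when (b′ w ∧ c′ w x) (v * u * F x w)) ⟩
    ∑[ w < n ] ∑[ x < m ] when (b′ w ∧ c′ w x) (v * u * F x w)
      ≈⟨ ∑-when-nested b′ c′ v u (λ w x → F x w) ⟨
    ∑[ w < n ] when (b′ w) (v * ∑[ x < m ] when (c′ w x) (u * F x w))
      ∎
    where
    open ≈-Reasoning
    reorder : ∀ x w → when (b x ∧ c x w) (u * v * F x w) ≈ when (b′ w ∧ c′ w x) (v * u * F x w)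
    reorder x w rewrite same x w = when-cong (b′ w ∧ c′ w x) (*-congʳ (*-comm u v))

  listSum : ∀ {A : Set} → List A → (A → Poly) → Poly
  listSum []       f = 0ₚ
  listSum (a ∷ as) f = f a + listSum as f

  listSum-cong : ∀ {A : Set} (as : List A) {f g : A → Poly} → (∀ a → f a ≈ g a) → listSum as f ≈ listSum as g
  listSum-cong []       f≈g = ≈-refl
  listSum-cong (a ∷ as) f≈g = +-cong (f≈g a) (listSum-cong as f≈g)

  listSum-++ : ∀ {A : Set} (as bs : List A) f → listSum (as ++ bs) f ≈ listSum as f + listSum bs f
  listSum-++ []       bs f = ≈-sym (+-identityˡ (listSum bs f))
  listSum-++ (a ∷ as) bs f = ≈-trans (+-congˡ (listSum-++ as bs f)) (≈-sym (+-assoc (f a) _ _))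

  listSum-map : ∀ {A B : Set} (as : List A) (g : A → B) f → listSum (List.map g as) f ≈ listSum as (f ∘ g)
  listSum-map []       g f = ≈-refl
  listSum-map (a ∷ as) g f = +-congˡ (listSum-map as g f)

  *-distribˡ-listSum : ∀ {A : Set} c (as : List A) f → c * listSum as f ≈ listSum as (λ a → c * f a)
  *-distribˡ-listSum c []       f = zeroʳ c
  *-distribˡ-listSum c (a ∷ as) f = ≈-trans (distribˡ c (f a) _) (+-congˡ (*-distribˡ-listSum c as f))

  listSum-∑ : ∀ {A : Set} {n} (as : List A) (f : A → Fin n → Poly) →
              listSum as (λ a → ∑[ x < n ] f a x) ≈ ∑[ x < n ] listSum as (λ a → f a x)
  listSum-∑ {n = n} []       f = ≈-sym (∑-zero {n} (λ _ → 0ₚ) (λ _ → ≈-refl))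
  listSum-∑ {n = n} (a ∷ as) f =
    ≈-trans (+-congˡ (listSum-∑ as f)) (≈-sym (∑-distrib-+ (f a) (λ x → listSum as (λ b → f b x))))

  listSum-when : ∀ {A : Set} (as : List A) b f → listSum as (λ a → when b (f a)) ≈ when b (listSum as f)
  listSum-when as       true  f = ≈-refl
  listSum-when []       false f = ≈-refl
  listSum-when (a ∷ as) false f = ≈-trans (+-identityˡ _) (listSum-when as false f)

module Order (R : RankedPoset) where
  open RankedPoset R using () renaming (_≤ᴾ_ to _≤_; _<ᴾ_ to _<_)

  <⇒≤ : ∀ {x y} → x < y → x ≤ y
  <⇒≤ = proj₁ ∘ to T-∧

  <⇒≢ : ∀ {x y} → x < y → x ≢ y
  <⇒≢ {x} {y} x<y with x Fin.≟ y
  ... | no x≢y = x≢y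
  ... | yes _  = ⊥-elim (proj₂ (to T-∧ x<y))

  ≤∧≢⇒< : ∀ {x y} → x ≤ y → x ≢ y → x < y
  ≤∧≢⇒< {x} {y} x≤y x≢y with x Fin.≟ y
  ... | no _    = from T-∧ (x≤y , _)
  ... | yes x≡y = ⊥-elim (x≢y x≡y)

  ≤⇒≡⊎< : ∀ {x y} → x ≤ y → x ≡ y ⊎ x < y
  ≤⇒≡⊎< {x} {y} x≤y with x Fin.≟ y
  ... | yes x≡y = inj₁ x≡y
  ... | no _    = inj₂ (from T-∧ (x≤y , _))

  <-irrefl : ∀ {x} → ¬ x < x
  <-irrefl x<x = <⇒≢ x<x refl

  between : Fin (size R) → Fin (size R) → ℕ → Fin (size R) → Bool
  between p z a x = (rk R x ≡ᵇ a) ∧ lt R p x ∧ lt R x z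

  lt-irrefl : ∀ x → lt R x x ≡ false
  lt-irrefl x with x Fin.≟ x
  ... | yes _  = ∧-zeroʳ (le R x x)
  ... | no x≢x = ⊥-elim (x≢x refl)

-- Weaker than IsGraded and closed under products; it is all the argument uses.
record IsRanked (R : RankedPoset) : Set where
  field
    ≤-refl  : ∀ x → _≤ᴾ_ R x x
    ≤-trans : ∀ {x y z} → _≤ᴾ_ R x y → _≤ᴾ_ R y z → _≤ᴾ_ R x z
    bot-min : ∀ x → _≤ᴾ_ R (bot R) x
    rk-bot  : rk R (bot R) ≡ 0
    rk-mono : ∀ {x y} → _<ᴾ_ R x y → rk R x ℕ.< rk R y

module IsRankedProperties {R : RankedPoset} (isRanked : IsRanked R) where
  open IsRanked isRanked public
  open RankedPoset R using () renaming (_≤ᴾ_ to _≤_; _<ᴾ_ to _<_)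
  open Order R

  <-trans : ∀ {x y z} → x < y → y < z → x < z
  <-trans x<y y<z = ≤∧≢⇒< (≤-trans (<⇒≤ x<y) (<⇒≤ y<z))
    λ { refl → ℕₚ.<-asym (rk-mono x<y) (rk-mono y<z) }

  rk-mono-≤ : ∀ {x y} → x ≤ y → rk R x ℕ.≤ rk R y
  rk-mono-≤ x≤y with ≤⇒≡⊎< x≤y
  ... | inj₁ refl = ℕₚ.≤-refl
  ... | inj₂ x<y  = ℕₚ.<⇒≤ (rk-mono x<y)

  rk-pos : ∀ {x} → bot R < x → 0 ℕ.< rk R x
  rk-pos {x} bot<x = subst (ℕ._< rk R x) rk-bot (rk-mono bot<x)

  ≢bot⇒bot< : ∀ {x} → x ≢ bot R → bot R < x
  ≢bot⇒bot< x≢bot = ≤∧≢⇒< (bot-min _) (x≢bot ∘ sym)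

  ≤bot⇒≡bot : ∀ {x} → x ≤ bot R → x ≡ bot R
  ≤bot⇒≡bot {x} x≤bot with ≤⇒≡⊎< x≤bot
  ... | inj₁ x≡bot = x≡bot
  ... | inj₂ x<bot = ⊥-elim (ℕₚ.n≮0 (subst (rk R x ℕ.<_) rk-bot (rk-mono x<bot)))

module _ {R : RankedPoset} (graded : IsGraded R) where
  open IsGraded graded
  open RankedPoset R using () renaming (_≤ᴾ_ to _≤_; _<ᴾ_ to _<_)
  open Order R

  private
    <-trans : ∀ {x y z} → x < y → y < z → x < z
    <-trans x<y y<z = ≤∧≢⇒< (trans≤ _ _ _ (<⇒≤ x<y) (<⇒≤ y<z))
      λ { refl → <⇒≢ x<y (antisym≤ _ _ (<⇒≤ x<y) (<⇒≤ y<z)) }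

    interval : Fin (size R) × Fin (size R) → Subset (size R)
    interval (x , y) = Vec.tabulate (λ w → lt R x w ∧ lt R w y)

    ∈-interval⁺ : ∀ {x y w} → x < w → w < y → w ∈ interval (x , y)
    ∈-interval⁺ {x} {y} {w} x<w w<y = Vecₚ.lookup⇒[]= w _
      (trans (Vecₚ.lookup∘tabulate (λ v → lt R x v ∧ lt R v y) w) (to T-≡ (from T-∧ (x<w , w<y))))

    ∈-interval⁻ : ∀ {x y w} → w ∈ interval (x , y) → x < w × w < y
    ∈-interval⁻ {x} {y} {w} w∈xy = to T-∧ (from T-≡
      (trans (sym (Vecₚ.lookup∘tabulate (λ v → lt R x v ∧ lt R v y) w)) (Vecₚ.[]=⇒lookup w∈xy)))

    lower-⊂ : ∀ {x w y} → x < w → w < y → interval (x , w) ⊂ interval (x , y)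
    lower-⊂ x<w w<y =
        (λ v∈xw → let (x<v , v<w) = ∈-interval⁻ v∈xw in ∈-interval⁺ x<v (<-trans v<w w<y))
      , _ , ∈-interval⁺ x<w w<y , λ w∈xw → <-irrefl (proj₂ (∈-interval⁻ w∈xw))

    upper-⊂ : ∀ {x w y} → x < w → w < y → interval (w , y) ⊂ interval (x , y)
    upper-⊂ x<w w<y =
        (λ v∈wy → let (w<v , v<y) = ∈-interval⁻ v∈wy in ∈-interval⁺ (<-trans x<w w<v) v<y)
      , _ , ∈-interval⁺ x<w w<y , λ w∈wy → <-irrefl (proj₁ (∈-interval⁻ w∈wy))

    -- Induction on the open interval (x, y): split it at an interior point, or else y covers x.
    rk-mono : ∀ {x y} → x < y → rk R x ℕ.< rk R y
    rk-mono {x} {y} = go (On.wellFounded interval ⊂-wellFounded (x , y))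
      where
      go : ∀ {x y} → Acc (λ p q → interval p ⊂ interval q) (x , y) → x < y → rk R x ℕ.< rk R y
      go {x} {y} (acc smaller) x<y with Finₚ.any? (λ w → T? (lt R x w ∧ lt R w y))
      ... | yes (w , x<w<y) = let (x<w , w<y) = to T-∧ x<w<y in
        ℕₚ.<-trans (go (smaller (lower-⊂ x<w w<y)) x<w) (go (smaller (upper-⊂ x<w w<y)) w<y)
      ... | no ∄w = ℕₚ.≤-reflexive (sym (rk-cover x y (x<y , covers)))
        where
        covers : ∀ w → ¬ (x < w × w < y)
        covers w (x<w , w<y) = ∄w (w , from T-∧ (x<w , w<y))

  graded⇒ranked : IsRanked R
  graded⇒ranked = record
    { ≤-refl = refl≤ ; ≤-trans = trans≤ _ _ _ ; bot-min = bot-min ; rk-bot = rk-bot ; rk-mono = rk-mono }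

module ProductPoset (P Q : RankedPoset) where
  split : Fin (size P ℕ.* size Q) → Fin (size P) × Fin (size Q)
  split = Fin.remQuot (size Q)

  split-combine : ∀ a b → split (Fin.combine a b) ≡ (a , b)
  split-combine = Finₚ.remQuot-combine

  split-injective : ∀ {z w} → split z ≡ split w → z ≡ w
  split-injective {z} {w} eq = begin
    z                                                ≡⟨ Finₚ.combine-remQuot {size P} (size Q) z ⟨
    Fin.combine (proj₁ (split z)) (proj₂ (split z))  ≡⟨ cong (λ (a , b) → Fin.combine a b) eq ⟩
    Fin.combine (proj₁ (split w)) (proj₂ (split w))  ≡⟨ Finₚ.combine-remQuot {size P} (size Q) w ⟩
    w                                                ∎
    where open ≡-Reasoning

  rank-× : rank (P ×ᴾ Q) ≡ rank P ℕ.+ rank Q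
  rank-× = cong (λ (a , b) → rk P a ℕ.+ rk Q b) (split-combine (top P) (top Q))

module _ {P Q : RankedPoset} (rankedP : IsRanked P) (rankedQ : IsRanked Q) where
  open ProductPoset P Q
  private
    module P = IsRankedProperties rankedP
    module Q = IsRankedProperties rankedQ
    module PQ = Order (P ×ᴾ Q)
    open Order using (≤⇒≡⊎<)

  ×-isRanked : IsRanked (P ×ᴾ Q)
  ×-isRanked = record
    { ≤-refl  = λ z → from T-∧ (P.≤-refl _ , Q.≤-refl _)
    ; ≤-trans = λ z≤w w≤v → let (z≤w₁ , z≤w₂) = to T-∧ z≤w ; (w≤v₁ , w≤v₂) = to T-∧ w≤v
                            in from T-∧ (P.≤-trans z≤w₁ w≤v₁ , Q.≤-trans z≤w₂ w≤v₂)
    ; bot-min = λ z → subst (λ (a , b) → T (le P a (proj₁ (split z)) ∧ le Q b (proj₂ (split z))))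
                            (sym (split-combine (bot P) (bot Q))) (from T-∧ (P.bot-min _ , Q.bot-min _))
    ; rk-bot  = trans (cong (λ (a , b) → rk P a ℕ.+ rk Q b) (split-combine (bot P) (bot Q)))
                      (cong₂ ℕ._+_ P.rk-bot Q.rk-bot)
    ; rk-mono = rk-mono
    }
    where
    rk-mono : ∀ {z w} → _<ᴾ_ (P ×ᴾ Q) z w → rk (P ×ᴾ Q) z ℕ.< rk (P ×ᴾ Q) w
    rk-mono {z} {w} z<w with to T-∧ (PQ.<⇒≤ z<w)
    ... | z≤w₁ , z≤w₂ with ≤⇒≡⊎< P z≤w₁ | ≤⇒≡⊎< Q z≤w₂
    ... | inj₁ eq₁  | inj₁ eq₂  = ⊥-elim (PQ.<⇒≢ z<w (split-injective (cong₂ _,_ eq₁ eq₂)))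
    ... | inj₁ eq₁  | inj₂ z<w₂ = ℕₚ.+-mono-≤-< (ℕₚ.≤-reflexive (cong (rk P) eq₁)) (Q.rk-mono z<w₂)
    ... | inj₂ z<w₁ | _         = ℕₚ.+-mono-<-≤ (P.rk-mono z<w₁) (Q.rk-mono-≤ z≤w₂)

module AbIndex where
  open Coefficients using (const; const-*ₚ)
  open Order using (between)
  open Series
  open FiniteSums

  -- Θ of a linear combination of words whose first letter sits at position i.
  Θ-from : ℕ → ABPoly → Poly
  Θ-from i []            = 0ₚ
  Θ-from i ((c , w) ∷ t) = const c * qpow (bPosSum i w) + Θ-from i t

  Θ≈Θ-from-1 : ∀ p → Θ p ≈ Θ-from 1 p
  Θ≈Θ-from-1 []            = ≈-refl
  Θ≈Θ-from-1 ((c , w) ∷ t) = mk≈ λ k → begin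
    (c ·ₚ Θword w) k ℤ.+ Θ t k
      ≡⟨ cong₂ ℤ._+_ (sym (const-*ₚ c (Θword w) k)) (coeff (Θ≈Θ-from-1 t) k) ⟩
    (const c *ₚ Θword w) k ℤ.+ Θ-from 1 t k
      ≡⟨ cong (ℤ._+ Θ-from 1 t k) (*-coeff (const c) (Θword w) k) ⟨
    (const c * Θword w) k ℤ.+ Θ-from 1 t k
      ≡⟨ +-coeff (const c * Θword w) (Θ-from 1 t) k ⟨
    (const c * qpow (bPosSum 1 w) + Θ-from 1 t) k
      ∎
    where open ≡-Reasoning

  Θ-from-++ : ∀ i p p′ → Θ-from i (p ++ p′) ≈ Θ-from i p + Θ-from i p′
  Θ-from-++ i []            p′ = ≈-sym (+-identityˡ (Θ-from i p′))
  Θ-from-++ i ((c , w) ∷ p) p′ = ≈-trans (+-congˡ (Θ-from-++ i p p′)) (≈-sym (+-assoc _ (Θ-from i p) _))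

  Θ-from-concatMap : ∀ {A : Set} i (h : A → ABPoly) as → Θ-from i (concatMap h as) ≈ listSum as (Θ-from i ∘ h)
  Θ-from-concatMap i h []       = ≈-refl
  Θ-from-concatMap i h (a ∷ as) =
    ≈-trans (Θ-from-++ i (h a) (concatMap h as)) (+-congˡ (Θ-from-concatMap i h as))

  Θ-from-scaleAB : ∀ i c p → Θ-from i (scaleAB c p) ≈ const c * Θ-from i p
  Θ-from-scaleAB i c []            = ≈-sym (zeroʳ (const c))
  Θ-from-scaleAB i c ((d , w) ∷ p) = begin
    const (c ℤ.* d) * qpow (bPosSum i w) + Θ-from i (scaleAB c p)
      ≈⟨ +-cong (*-congʳ (const-* c d)) (Θ-from-scaleAB i c p) ⟩
    const c * const d * qpow (bPosSum i w) + const c * Θ-from i p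
      ≈⟨ +-congʳ (*-assoc (const c) (const d) _) ⟩
    const c * (const d * qpow (bPosSum i w)) + const c * Θ-from i p
      ≈⟨ distribˡ (const c) _ _ ⟨
    const c * (const d * qpow (bPosSum i w) + Θ-from i p)
      ∎
    where open ≈-Reasoning

  letterWeight : ℕ → Letter → Poly
  letterWeight i 𝐚 = 1ₚ
  letterWeight i 𝐛 = qpow i

  qpow-bPosSum : ∀ i l w → qpow (bPosSum i (l ∷ w)) ≈ letterWeight i l * qpow (bPosSum (suc i) w)
  qpow-bPosSum i 𝐚 w = ≈-sym (*-identityˡ _)
  qpow-bPosSum i 𝐛 w = qpow-+ i (bPosSum (suc i) w)

  prefix : ℤ → Letter → ABPoly → ABPoly
  prefix c l = List.map (λ (d , w) → (c ℤ.* d , l ∷ w))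

  Θ-from-prefix : ∀ i c l p → Θ-from i (prefix c l p) ≈ const c * letterWeight i l * Θ-from (suc i) p
  Θ-from-prefix i c l []            = ≈-sym (zeroʳ _)
  Θ-from-prefix i c l ((d , w) ∷ p) = begin
    const (c ℤ.* d) * qpow (bPosSum i (l ∷ w)) + Θ-from i (prefix c l p)
      ≈⟨ +-cong (*-cong (const-* c d) (qpow-bPosSum i l w)) (Θ-from-prefix i c l p) ⟩
    const c * const d * (letterWeight i l * qpow (bPosSum (suc i) w)) + const c * letterWeight i l * Θ-from (suc i) p
      ≈⟨ regroup (const c) (const d) (letterWeight i l) _ _ ⟩
    const c * letterWeight i l * (const d * qpow (bPosSum (suc i) w) + Θ-from (suc i) p)
      ∎
    where
    open ≈-Reasoning
    open PolySolver
    regroup : ∀ c d x y t → c * d * (x * y) + c * x * t ≈ c * x * (d * y + t)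
    regroup = solve 5 (λ c d x y t → c :* d :* (x :* y) :+ c :* x :* t := c :* x :* (d :* y :+ t)) ≈-refl

  -- Θ(v_S) when S lists membership of i, i + 1, … as in vS.
  vWeight : ℕ → List Bool → Poly
  vWeight i []          = 1ₚ
  vWeight i (true ∷ S)  = qpow i * vWeight (suc i) S
  vWeight i (false ∷ S) = 1-q^ i * vWeight (suc i) S

  Θ-from-vS : ∀ i S → Θ-from i (vS S) ≈ vWeight i S
  Θ-from-vS i []          = ≈-trans (+-identityʳ (1ₚ * 1ₚ)) (*-identityʳ 1ₚ)
  Θ-from-vS i (true ∷ S)  = begin
    Θ-from i (prefix (+ 1) 𝐛 (vS S) ++ [])
      ≈⟨ ≈-trans (Θ-from-++ i (prefix (+ 1) 𝐛 (vS S)) []) (+-identityʳ _) ⟩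
    Θ-from i (prefix (+ 1) 𝐛 (vS S))
      ≈⟨ Θ-from-prefix i (+ 1) 𝐛 (vS S) ⟩
    1ₚ * qpow i * Θ-from (suc i) (vS S)
      ≈⟨ *-cong (*-identityˡ (qpow i)) (Θ-from-vS (suc i) S) ⟩
    qpow i * vWeight (suc i) S
      ∎
    where open ≈-Reasoning
  Θ-from-vS i (false ∷ S) = begin
    Θ-from i (prefix (+ 1) 𝐚 (vS S) ++ (prefix ℤ.-1ℤ 𝐛 (vS S) ++ []))
      ≈⟨ Θ-from-++ i (prefix (+ 1) 𝐚 (vS S)) _ ⟩
    Θ-from i (prefix (+ 1) 𝐚 (vS S)) + Θ-from i (prefix ℤ.-1ℤ 𝐛 (vS S) ++ [])
      ≈⟨ +-congˡ (≈-trans (Θ-from-++ i (prefix ℤ.-1ℤ 𝐛 (vS S)) []) (+-identityʳ _)) ⟩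
    Θ-from i (prefix (+ 1) 𝐚 (vS S)) + Θ-from i (prefix ℤ.-1ℤ 𝐛 (vS S))
      ≈⟨ +-cong (Θ-from-prefix i (+ 1) 𝐚 (vS S)) (Θ-from-prefix i ℤ.-1ℤ 𝐛 (vS S)) ⟩
    1ₚ * 1ₚ * W + const ℤ.-1ℤ * qpow i * W
      ≈⟨ collect (qpow i) W ⟩
    1-q^ i * W
      ≈⟨ *-congˡ (Θ-from-vS (suc i) S) ⟩
    1-q^ i * vWeight (suc i) S
      ∎
    where
    open ≈-Reasoning
    open PolySolver
    W = Θ-from (suc i) (vS S)
    collect : ∀ q w → 1ₚ * 1ₚ * w + const ℤ.-1ℤ * q * w ≈ (1ₚ + - q) * w
    collect = solve 2 (λ q w → con (+ 1) :* con (+ 1) :* w :+ con ℤ.-1ℤ :* q :* w := (con (+ 1) :- q) :* w) ≈-refl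

  -- Θ(Σ_S f_S v_S) for the chains p < x₁ < ⋯ < x_k < 1̂ with rank set S ⊆ {a, …, a + len - 1}.
  flagSum : (R : RankedPoset) → Fin (size R) → ℕ → ℕ → Poly
  flagSum R p a len = listSum (subsets len) (λ S → const (+ countChains R p (elems a S)) * vWeight a S)

  Θ-Ψ : ∀ R → Θ (Ψ R) ≈ flagSum R (bot R) 1 (rank R ∸ 1)
  Θ-Ψ R = begin
    Θ (Ψ R)         ≈⟨ Θ≈Θ-from-1 (Ψ R) ⟩
    Θ-from 1 (Ψ R)  ≈⟨ Θ-from-concatMap 1 _ subs ⟩
    listSum subs (λ S → Θ-from 1 (scaleAB (+ flagF R S) (vS S)))
      ≈⟨ listSum-cong subs (λ S → ≈-trans (Θ-from-scaleAB 1 _ (vS S)) (*-congˡ (Θ-from-vS 1 S))) ⟩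
    flagSum R (bot R) 1 (rank R ∸ 1)
      ∎
    where
    open ≈-Reasoning
    subs = subsets (rank R ∸ 1)

  private
    const-sumFin : ∀ {n} (g : Fin n → ℕ) → const (+ sumFin g) ≈ ∑[ x < n ] const (+ g x)
    const-sumFin {zero}  g = const-0
    const-sumFin {suc n} g = ≈-trans (const-+ (+ g Fin.zero) _) (+-congˡ (const-sumFin (g ∘ Fin.suc)))

    const-if : ∀ b m → const (+ (if b then m else 0)) ≈ when b (const (+ m))
    const-if true  m = ≈-refl
    const-if false m = const-0

  -- The first level a either is skipped, with weight 1 - q^a, or carries the first element x of the chain.
  flagSum-suc : ∀ R p a len →
    flagSum R p a (suc len)
    ≈ 1-q^ a * flagSum R p (suc a) len
      + ∑[ x < size R ] when (between R p (top R) a x) (qpow a * flagSum R x (suc a) len)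
  flagSum-suc R p a len = begin
    listSum (List.map (true ∷_) subs ++ List.map (false ∷_) subs) F
      ≈⟨ listSum-++ (List.map (true ∷_) subs) _ F ⟩
    listSum (List.map (true ∷_) subs) F + listSum (List.map (false ∷_) subs) F
      ≈⟨ +-comm _ _ ⟩
    listSum (List.map (false ∷_) subs) F + listSum (List.map (true ∷_) subs) F
      ≈⟨ +-cong (≈-trans (listSum-map subs (false ∷_) F) skipLevel)
                (≈-trans (listSum-map subs (true ∷_) F) useLevel) ⟩
    1-q^ a * flagSum R p (suc a) len + ∑[ x < size R ] when (step x) (qpow a * flagSum R x (suc a) len)
      ∎
    where
    open ≈-Reasoning
    open PolySolver
    subs = subsets len
    step : Fin (size R) → Bool
    step = between R p (top R) a
    count : Fin (size R) → List Bool → Poly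
    count x S = const (+ countChains R x (elems (suc a) S))
    F : List Bool → Poly
    F S = const (+ countChains R p (elems a S)) * vWeight a S
    swap : ∀ c u w → c * (u * w) ≈ u * (c * w)
    swap = solve 3 (λ c u w → c :* (u :* w) := u :* (c :* w)) ≈-refl
    skipLevel : listSum subs (F ∘ (false ∷_)) ≈ 1-q^ a * flagSum R p (suc a) len
    skipLevel = ≈-trans (listSum-cong subs (λ S → swap (count p S) (1-q^ a) (vWeight (suc a) S)))
                        (≈-sym (*-distribˡ-listSum (1-q^ a) subs _))
    first : ∀ S → F (true ∷ S) ≈ ∑[ x < size R ] (when (step x) (count x S) * (qpow a * vWeight (suc a) S))
    first S = ≈-trans (*-congʳ (≈-trans (const-sumFin {size R} _) (sum-cong-≋ {size R} λ x → const-if (step x) _)))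
                      (*-distribʳ-sum {size R} _ (λ x → when (step x) (count x S)))
    pullOut : ∀ x → listSum subs (λ S → when (step x) (count x S) * (qpow a * vWeight (suc a) S))
                    ≈ when (step x) (qpow a * flagSum R x (suc a) len)
    pullOut x = begin
      listSum subs (λ S → when (step x) (count x S) * (qpow a * vWeight (suc a) S))
        ≈⟨ listSum-cong subs (λ S → ≈-trans (when-*ˡ (step x) _ _) (when-cong (step x) (swap _ _ _))) ⟩
      listSum subs (λ S → when (step x) (qpow a * (count x S * vWeight (suc a) S)))
        ≈⟨ listSum-when subs (step x) _ ⟩
      when (step x) (listSum subs (λ S → qpow a * (count x S * vWeight (suc a) S)))
        ≈⟨ when-cong (step x) (*-distribˡ-listSum (qpow a) subs _) ⟨
      when (step x) (qpow a * flagSum R x (suc a) len)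
        ∎
    useLevel : listSum subs (F ∘ (true ∷_)) ≈ ∑[ x < size R ] when (step x) (qpow a * flagSum R x (suc a) len)
    useLevel = begin
      listSum subs (F ∘ (true ∷_))
        ≈⟨ listSum-cong subs first ⟩
      listSum subs (λ S → ∑[ x < size R ] (when (step x) (count x S) * (qpow a * vWeight (suc a) S)))
        ≈⟨ listSum-∑ {n = size R} subs _ ⟩
      ∑[ x < size R ] listSum subs (λ S → when (step x) (count x S) * (qpow a * vWeight (suc a) S))
        ≈⟨ sum-cong-≋ {size R} pullOut ⟩
      ∑[ x < size R ] when (step x) (qpow a * flagSum R x (suc a) len)
        ∎

module Chains (R : RankedPoset) where
  open Series
  open FiniteSums
  open AbIndex using (flagSum; flagSum-suc)
  open Order using (between)
  open RankedPoset R using () renaming (_<ᴾ_ to _<_)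

  chainWeight : ℕ → Poly
  chainWeight a = qpow a * geometric a

  -- Σ over the chains p < x₁ < ⋯ < x_k < z with all ranks in {a, …, a + len - 1}
  -- of ∏ᵢ q^ρ(xᵢ) / (1 - q^ρ(xᵢ)).
  chainSum : Fin (size R) → Fin (size R) → ℕ → ℕ → Poly
  chainSum p z a zero      = 1ₚ
  chainSum p z a (suc len) =
    chainSum p z (suc a) len + ∑[ x < size R ] when (between R p z a x) (chainWeight a * chainSum x z (suc a) len)

  1-q^-*-chainWeight : ∀ {a} → 0 ℕ.< a → 1-q^ a * chainWeight a ≈ qpow a
  1-q^-*-chainWeight {a} 0<a = begin
    1-q^ a * (qpow a * geometric a)    ≈⟨ swap (1-q^ a) (qpow a) (geometric a) ⟩
    qpow a * (1-q^ a * geometric a)    ≈⟨ *-congˡ (1-q^-*-geometric 0<a) ⟩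
    qpow a * 1ₚ                        ≈⟨ *-identityʳ (qpow a) ⟩
    qpow a                             ∎
    where
    open ≈-Reasoning
    open PolySolver
    swap : ∀ u x g → u * (x * g) ≈ x * (u * g)
    swap = solve 3 (λ u x g → u :* (x :* g) := x :* (u :* g)) ≈-refl

  pochhammer-*-chainSum : ∀ len p a →
    pochhammer (suc a) len * chainSum p (top R) (suc a) len ≈ flagSum R p (suc a) len
  pochhammer-*-chainSum zero      p a = ≈-sym (+-identityʳ (1ₚ * 1ₚ))
  pochhammer-*-chainSum (suc len) p a = begin
    1-q^ b * E * (C p + ∑[ x < size R ] when (step x) (chainWeight b * C x))
      ≈⟨ distribˡ _ _ _ ⟩
    1-q^ b * E * C p + 1-q^ b * E * ∑[ x < size R ] when (step x) (chainWeight b * C x)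
      ≈⟨ +-cong (*-assoc (1-q^ b) E (C p)) (*-∑-when (1-q^ b * E) step (λ x → chainWeight b * C x)) ⟩
    1-q^ b * (E * C p) + ∑[ x < size R ] when (step x) (1-q^ b * E * (chainWeight b * C x))
      ≈⟨ +-cong (*-congˡ (pochhammer-*-chainSum len p b))
                (sum-cong-≋ {size R} (λ x → when-cong (step x) (level x))) ⟩
    1-q^ b * flagSum R p (suc b) len + ∑[ x < size R ] when (step x) (qpow b * flagSum R x (suc b) len)
      ≈⟨ flagSum-suc R p b len ⟨
    flagSum R p b (suc len)
      ∎
    where
    open ≈-Reasoning
    open PolySolver
    b = suc a
    E = pochhammer (suc b) len
    C : Fin (size R) → Poly
    C x = chainSum x (top R) (suc b) len
    step : Fin (size R) → Bool
    step = between R p (top R) b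
    regroup : ∀ u e w c → u * e * (w * c) ≈ u * w * (e * c)
    regroup = solve 4 (λ u e w c → u :* e :* (w :* c) := u :* w :* (e :* c)) ≈-refl
    level : ∀ x → 1-q^ b * E * (chainWeight b * C x) ≈ qpow b * flagSum R x (suc b) len
    level x = ≈-trans (regroup (1-q^ b) E (chainWeight b) (C x))
                      (*-cong (1-q^-*-chainWeight (s≤s z≤n)) (pochhammer-*-chainSum len x b))

  inLevels : ℕ → ℕ → ℕ → Bool
  inLevels a len r = does (a ℕₚ.≤? r) ∧ does (r ℕₚ.<? a ℕ.+ len)

  private
    levelStep : ∀ a len r o (X Y : Poly) → (r ≡ a ℕ.+ len → X ≈ Y) →
      when ((does (a ℕₚ.≤? r) ∧ does (r ℕₚ.<? a ℕ.+ suc len)) ∧ o) X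
      ≈ when ((does (a ℕₚ.≤? r) ∧ does (r ℕₚ.<? a ℕ.+ len)) ∧ o) X
        + when (does (r ℕₚ.≟ a ℕ.+ len) ∧ o) Y
    levelStep a len r o X Y X≈Y rewrite ℕₚ.+-suc a len with ℕₚ.<-cmp r (a ℕ.+ len)
    ... | tri< r<t _ _
      rewrite dec-true (r ℕₚ.<? suc (a ℕ.+ len)) (ℕₚ.m<n⇒m<1+n r<t)
            | dec-true (r ℕₚ.<? a ℕ.+ len) r<t
            | dec-false (r ℕₚ.≟ a ℕ.+ len) (ℕₚ.<⇒≢ r<t)
      = ≈-sym (+-identityʳ _)
    ... | tri> _ _ t<r
      rewrite dec-false (r ℕₚ.<? suc (a ℕ.+ len)) (ℕₚ.<⇒≱ t<r ∘ ℕₚ.≤-pred)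
            | dec-false (r ℕₚ.<? a ℕ.+ len) (ℕₚ.<⇒≯ t<r)
            | dec-false (r ℕₚ.≟ a ℕ.+ len) (ℕₚ.>⇒≢ t<r)
      = ≈-sym (+-identityʳ _)
    ... | tri≈ _ refl _
      rewrite dec-true (a ℕₚ.≤? a ℕ.+ len) (ℕₚ.m≤m+n a len)
            | dec-true (a ℕ.+ len ℕₚ.<? suc (a ℕ.+ len)) (ℕₚ.n<1+n _)
            | dec-false (a ℕ.+ len ℕₚ.<? a ℕ.+ len) (ℕₚ.<-irrefl refl)
            | dec-true (a ℕ.+ len ℕₚ.≟ a ℕ.+ len) refl
      = ≈-trans (when-cong o (X≈Y refl)) (≈-sym (+-identityˡ _))

    noLevels : ∀ a r → inLevels a 0 r ≡ false
    noLevels a r with ℕₚ.<-≤-connex r a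
    ... | inj₁ r<a rewrite dec-false (a ℕₚ.≤? r) (ℕₚ.<⇒≱ r<a) = refl
    ... | inj₂ a≤r rewrite ℕₚ.+-identityʳ a | dec-false (r ℕₚ.<? a) (ℕₚ.≤⇒≯ a≤r) = ∧-zeroʳ _

  module _ (<-trans : ∀ {x y z} → x < y → y < z → x < z) where

    private
      unpack : ∀ {p z a x} → T (between R p z a x) → T (rk R x ≡ᵇ a) × p < x × x < z
      unpack t = let (r , t′) = to T-∧ t in r , to T-∧ t′

      pack : ∀ {p z a x} → T (rk R x ≡ᵇ a) → p < x → x < z → T (between R p z a x)
      pack r p<x x<z = from T-∧ (r , from T-∧ (p<x , x<z))

    between-swap : ∀ p z a t x w → between R p z a x ∧ between R x z t w ≡ between R p z t w ∧ between R p w a x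
    between-swap p z a t x w = T-injective
      (λ both → let (xz , wz) = to T-∧ both ; (ra , p<x , _) = unpack xz ; (rt , x<w , w<z) = unpack wz
                in from T-∧ (pack rt (<-trans p<x x<w) w<z , pack ra p<x x<w))
      (λ both → let (wz , xw) = to T-∧ both ; (rt , _ , w<z) = unpack wz ; (ra , p<x , x<w) = unpack xw
                in from T-∧ (pack ra p<x (<-trans x<w w<z) , pack rt x<w w<z))

    -- chainSum splits off the first element of a chain; splitting off the last one needs transitivity.
    chainSum-snoc : ∀ len p z a →
      chainSum p z a (suc len)
      ≈ chainSum p z a len
        + ∑[ w < size R ] when (between R p z (a ℕ.+ len) w) (chainWeight (a ℕ.+ len) * chainSum p w a len)
    chainSum-snoc zero    p z a rewrite ℕₚ.+-identityʳ a = ≈-refl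
    chainSum-snoc (suc l) p z a rewrite ℕₚ.+-suc a l = begin
      chainSum p z (suc a) (suc l) + ∑[ x < size R ] when (first x) (chainWeight a * chainSum x z (suc a) (suc l))
        ≈⟨ +-cong (chainSum-snoc l p z (suc a))
                  (sum-cong-≋ {size R} λ x → when-cong (first x) (*-congˡ (chainSum-snoc l x z (suc a)))) ⟩
      (chainSum p z (suc a) l + last p z)
        + ∑[ x < size R ] when (first x) (chainWeight a * (chainSum x z (suc a) l + last x z))
        ≈⟨ +-congˡ (∑-when-*-+ first (chainWeight a) _ _) ⟩
      (chainSum p z (suc a) l + last p z)
        + (∑[ x < size R ] when (first x) (chainWeight a * chainSum x z (suc a) l)
           + ∑[ x < size R ] when (first x) (chainWeight a * last x z))
        ≈⟨ interchange _ _ _ _ ⟩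
      chainSum p z a (suc l) + (last p z + ∑[ x < size R ] when (first x) (chainWeight a * last x z))
        ≈⟨ +-congˡ (+-congˡ (∑-when-nested-comm first (λ x → between R x z t) (between R p z t)
                               (λ w → between R p w a) (chainWeight a) (chainWeight t)
                               (λ x w → chainSum x w (suc a) l) (between-swap p z a t))) ⟩
      chainSum p z a (suc l) + (last p z + ∑[ w < size R ] when (between R p z t w) (chainWeight t * firstSteps w))
        ≈⟨ +-congˡ (∑-when-*-+ (between R p z t) (chainWeight t) (λ w → chainSum p w (suc a) l) firstSteps) ⟨
      chainSum p z a (suc l) + ∑[ w < size R ] when (between R p z t w) (chainWeight t * chainSum p w a (suc l))
        ∎
      where
      open ≈-Reasoning
      open import Algebra.Properties.CommutativeSemigroup (CommutativeRing.+-commutativeSemigroup PolyRing)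
        using (interchange)
      t = suc (a ℕ.+ l)
      first : Fin (size R) → Bool
      first = between R p z a
      last : Fin (size R) → Fin (size R) → Poly
      last y z′ = ∑[ w < size R ] when (between R y z′ t w) (chainWeight t * chainSum y w (suc a) l)
      firstSteps : Fin (size R) → Poly
      firstSteps w = ∑[ x < size R ] when (between R p w a x) (chainWeight a * chainSum x w (suc a) l)

    chainSum-last : ∀ len p z a →
      chainSum p z a len
      ≈ 1ₚ + ∑[ w < size R ] when (inLevels a len (rk R w) ∧ lt R p w ∧ lt R w z)
                                  (chainWeight (rk R w) * chainSum p w a (rk R w ∸ a))
    chainSum-last zero p z a = ≈-sym (≈-trans (+-congˡ (∑-zero {size R} _ vanish)) (+-identityʳ 1ₚ))
      where
      vanish : ∀ w → when (inLevels a 0 (rk R w) ∧ lt R p w ∧ lt R w z)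
                          (chainWeight (rk R w) * chainSum p w a (rk R w ∸ a)) ≈ 0ₚ
      vanish w rewrite noLevels a (rk R w) = ≈-refl
    chainSum-last (suc len) p z a = begin
      chainSum p z a (suc len)
        ≈⟨ chainSum-snoc len p z a ⟩
      chainSum p z a len + ∑[ w < size R ] when (between R p z t w) (Y w)
        ≈⟨ +-congʳ (chainSum-last len p z a) ⟩
      1ₚ + ∑[ w < size R ] when (earlier w) (X w) + ∑[ w < size R ] when (between R p z t w) (Y w)
        ≈⟨ +-assoc 1ₚ _ _ ⟩
      1ₚ + (∑[ w < size R ] when (earlier w) (X w) + ∑[ w < size R ] when (between R p z t w) (Y w))
        ≈⟨ +-congˡ (∑-distrib-+ (λ w → when (earlier w) (X w)) _) ⟨
      1ₚ + ∑[ w < size R ] (when (earlier w) (X w) + when (between R p z t w) (Y w))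
        ≈⟨ +-congˡ (sum-cong-≋ {size R} λ w → levelStep a len (rk R w) (order w) (X w) (Y w) (lastLevel w)) ⟨
      1ₚ + ∑[ w < size R ] when (inLevels a (suc len) (rk R w) ∧ order w) (X w)
        ∎
      where
      open ≈-Reasoning
      t = a ℕ.+ len
      order : Fin (size R) → Bool
      order w = lt R p w ∧ lt R w z
      earlier : Fin (size R) → Bool
      earlier w = inLevels a len (rk R w) ∧ order w
      X Y : Fin (size R) → Poly
      X w = chainWeight (rk R w) * chainSum p w a (rk R w ∸ a)
      Y w = chainWeight t * chainSum p w a len
      lastLevel : ∀ w → rk R w ≡ t → X w ≈ Y w
      lastLevel w r≡t rewrite r≡t | ℕₚ.m+n∸m≡n a len = ≈-refl

module Multichains where
  open Series
  open FiniteSums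
  open AbIndex using (Θ-Ψ)

  -- The recurrence of M(z) = Σ q^(ρ y₁ + ⋯ + ρ y_t) over the multichains 0̂ < y₁ ≤ ⋯ ≤ y_t ≤ z, split by the
  -- last element w, where w = 0̂ (of rank 0) stands for the empty multichain.
  record IsMultichainSeries (R : RankedPoset) (F : Fin (size R) → Poly) : Set where
    field
      at-bot     : F (bot R) ≈ 1ₚ
      recurrence : ∀ z → F z ≈ ∑[ w < size R ] when (le R w z) (qpow (rk R w) * F w)

  module _ {R : RankedPoset} (ranked : IsRanked R) where
    open IsRankedProperties ranked

    -- Coefficient k of the recurrence involves F only through F 0̂ and through coefficients below k.
    multichainSeries-unique : ∀ {F G} → IsMultichainSeries R F → IsMultichainSeries R G → ∀ z → F z ≈ G z
    multichainSeries-unique {F} {G} isF isG z = mk≈ λ k → <-rec (λ k → ∀ z → F z k ≡ G z k) step k z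
      where
      module F = IsMultichainSeries isF
      module G = IsMultichainSeries isG
      term : ∀ w k → (∀ {j} → j ℕ.< k → F w j ≡ G w j) → (qpow (rk R w) * F w) k ≡ (qpow (rk R w) * G w) k
      term w k ih with w Fin.≟ bot R
      ... | yes refl = coeff (*-congˡ (≈-trans F.at-bot (≈-sym G.at-bot))) k
      ... | no w≢bot = qpow-*-coeff-cong (F w) (G w) k (rk-pos (≢bot⇒bot< w≢bot)) ih
      when-coeff : ∀ b {X Y : Poly} k → X k ≡ Y k → when b X k ≡ when b Y k
      when-coeff true  k eq = eq
      when-coeff false k eq = refl
      step : ∀ k → (∀ {j} → j ℕ.< k → ∀ z → F z j ≡ G z j) → ∀ z → F z k ≡ G z k
      step k ih z = begin
        F z k
          ≡⟨ coeff (F.recurrence z) k ⟩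
        (∑[ w < size R ] when (le R w z) (qpow (rk R w) * F w)) k
          ≡⟨ ∑-coeff-cong _ _ k (λ w → when-coeff (le R w z) k (term w k (λ j<k → ih j<k w))) ⟩
        (∑[ w < size R ] when (le R w z) (qpow (rk R w) * G w)) k
          ≡⟨ coeff (G.recurrence z) k ⟨
        G z k
          ∎
        where open ≡-Reasoning

  -- The elements of a multichain below z, other than z itself, form a chain x₁ < ⋯ < x_k < z in which each xᵢ
  -- occurs at least once (chainWeight) and z any number of times (geometric). For z = 0̂ both factors are 1ₚ.
  multichainSeries : (R : RankedPoset) → Fin (size R) → Poly
  multichainSeries R z = geometric (rk R z) * Chains.chainSum R (bot R) z 1 (rk R z ∸ 1)

  module _ {R : RankedPoset} (ranked : IsRanked R) where
    open IsRankedProperties ranked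
    open Order R
    open Chains R
    open RankedPoset R using () renaming (_<ᴾ_ to _<_)

    private
      Φ : Fin (size R) → Poly
      Φ = multichainSeries R

      X : Fin (size R) → Poly
      X w = qpow (rk R w) * Φ w

      split-bot : ∀ z w →
        when (le R w z) (X w) ≈ when (does (w Fin.≟ bot R)) (X w) + when (lt R (bot R) w ∧ le R w z) (X w)
      split-bot z w with w Fin.≟ bot R
      ... | yes refl rewrite to T-≡ (bot-min z) | lt-irrefl (bot R) = ≈-sym (+-identityʳ _)
      ... | no w≢bot rewrite to T-≡ (≢bot⇒bot< w≢bot) = ≈-sym (+-identityˡ _)

      split-top : ∀ {z} → bot R < z → ∀ w →
        when (lt R (bot R) w ∧ le R w z) (X w) ≈ when (does (w Fin.≟ z)) (X w) + when (lt R (bot R) w ∧ lt R w z) (X w)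
      split-top {z} bot<z w with w Fin.≟ z
      ... | yes refl rewrite to T-≡ bot<z | to T-≡ (≤-refl w) = ≈-sym (+-identityʳ _)
      ... | no w≢z rewrite ∧-identityʳ (le R w z) = ≈-sym (+-identityˡ _)

      levels : ∀ {z w} → inLevels 1 (rk R z ∸ 1) (rk R w) ∧ lt R (bot R) w ∧ lt R w z ≡ lt R (bot R) w ∧ lt R w z
      levels {z} {w} = T-injective (proj₂ ∘ to (T-∧ {inLevels 1 (rk R z ∸ 1) (rk R w)})) λ bot<w<z →
        let (bot<w , w<z) = to T-∧ bot<w<z
            1+[s∸1]≡s = ℕₚ.m+[n∸m]≡n (ℕₚ.≤-trans (rk-pos bot<w) (ℕₚ.<⇒≤ (rk-mono w<z)))
            w-above = T-does (1 ℕₚ.≤? rk R w) (rk-pos bot<w)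
            w-below = T-does (rk R w ℕₚ.<? 1 ℕ.+ (rk R z ∸ 1)) (subst (rk R w ℕ.<_) (sym 1+[s∸1]≡s) (rk-mono w<z))
        in from T-∧ (from T-∧ (w-above , w-below) , bot<w<z)

      chainSum-below : ∀ {z} → bot R < z →
        chainSum (bot R) z 1 (rk R z ∸ 1) ≈ 1ₚ + ∑[ w < size R ] when (lt R (bot R) w ∧ lt R w z) (X w)
      chainSum-below {z} bot<z =
        ≈-trans (chainSum-last <-trans (rk R z ∸ 1) (bot R) z 1) (+-congˡ (sum-cong-≋ {size R} term))
        where
        open PolySolver using (solve; _:*_; _:=_)
        term : ∀ w → when (inLevels 1 (rk R z ∸ 1) (rk R w) ∧ lt R (bot R) w ∧ lt R w z)
                          (chainWeight (rk R w) * chainSum (bot R) w 1 (rk R w ∸ 1))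
                     ≈ when (lt R (bot R) w ∧ lt R w z) (X w)
        term w rewrite levels {z} {w} = when-cong (lt R (bot R) w ∧ lt R w z)
          (solve 3 (λ x g c → x :* g :* c := x :* (g :* c)) ≈-refl (qpow (rk R w)) (geometric (rk R w)) _)

      Φ-bot : Φ (bot R) ≈ 1ₚ
      Φ-bot rewrite rk-bot = ≈-trans (*-congʳ geometric-zero) (*-identityˡ 1ₚ)

      ∑-split-bot : ∀ z →
        ∑[ w < size R ] when (le R w z) (X w) ≈ 1ₚ + ∑[ w < size R ] when (lt R (bot R) w ∧ le R w z) (X w)
      ∑-split-bot z = begin
        ∑[ w < size R ] when (le R w z) (X w)
          ≈⟨ sum-cong-≋ {size R} (split-bot z) ⟩
        ∑[ w < size R ] (when (does (w Fin.≟ bot R)) (X w) + when (lt R (bot R) w ∧ le R w z) (X w))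
          ≈⟨ ∑-distrib-+ (λ w → when (does (w Fin.≟ bot R)) (X w)) _ ⟩
        ∑[ w < size R ] when (does (w Fin.≟ bot R)) (X w) + ∑[ w < size R ] when (lt R (bot R) w ∧ le R w z) (X w)
          ≈⟨ +-congʳ (≈-trans (∑-when-≡ (bot R) X) X-bot) ⟩
        1ₚ + ∑[ w < size R ] when (lt R (bot R) w ∧ le R w z) (X w)
          ∎
        where
        open ≈-Reasoning
        X-bot : X (bot R) ≈ 1ₚ
        X-bot = ≈-trans (*-congʳ (≈-reflexive (cong qpow rk-bot))) (≈-trans (*-identityˡ (Φ (bot R))) Φ-bot)

    multichainSeries-isMultichainSeries : IsMultichainSeries R (multichainSeries R)
    multichainSeries-isMultichainSeries = record { at-bot = Φ-bot ; recurrence = recurrence }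
      where
      recurrence : ∀ z → Φ z ≈ ∑[ w < size R ] when (le R w z) (X w)
      recurrence z with z Fin.≟ bot R
      ... | yes refl = begin
        Φ (bot R)
          ≈⟨ Φ-bot ⟩
        1ₚ
          ≈⟨ +-identityʳ 1ₚ ⟨
        1ₚ + 0ₚ
          ≈⟨ +-congˡ (∑-zero {size R} _ nothingBelow) ⟨
        1ₚ + ∑[ w < size R ] when (lt R (bot R) w ∧ le R w (bot R)) (X w)
          ≈⟨ ∑-split-bot (bot R) ⟨
        ∑[ w < size R ] when (le R w (bot R)) (X w)
          ∎
        where
        open ≈-Reasoning
        nothingBelow : ∀ w → when (lt R (bot R) w ∧ le R w (bot R)) (X w) ≈ 0ₚ
        nothingBelow w rewrite T-injective {lt R (bot R) w ∧ le R w (bot R)} {false}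
          (λ t → let (bot<w , w≤bot) = to T-∧ t in <-irrefl (subst (bot R <_) (≤bot⇒≡bot w≤bot) bot<w)) (λ ())
          = ≈-refl
      ... | no z≢bot = begin
        geometric (rk R z) * chainSum (bot R) z 1 (rk R z ∸ 1)
          ≈⟨ *-congˡ (chainSum-below bot<z) ⟩
        geometric (rk R z) * (1ₚ + S)
          ≈⟨ geometric-unfold (rk-pos bot<z) (1ₚ + S) ⟩
        1ₚ + S + qpow (rk R z) * (geometric (rk R z) * (1ₚ + S))
          ≈⟨ +-congˡ (*-congˡ (*-congˡ (chainSum-below bot<z))) ⟨
        1ₚ + S + X z
          ≈⟨ solve 3 (λ a b c → a :+ b :+ c := a :+ (c :+ b)) ≈-refl 1ₚ S (X z) ⟩
        1ₚ + (X z + S)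
          ≈⟨ +-congˡ (+-congʳ (∑-when-≡ z X)) ⟨
        1ₚ + (∑[ w < size R ] when (does (w Fin.≟ z)) (X w) + S)
          ≈⟨ +-congˡ (∑-distrib-+ (λ w → when (does (w Fin.≟ z)) (X w)) _) ⟨
        1ₚ + ∑[ w < size R ] (when (does (w Fin.≟ z)) (X w) + when (lt R (bot R) w ∧ lt R w z) (X w))
          ≈⟨ +-congˡ (sum-cong-≋ {size R} (split-top bot<z)) ⟨
        1ₚ + ∑[ w < size R ] when (lt R (bot R) w ∧ le R w z) (X w)
          ≈⟨ ∑-split-bot z ⟨
        ∑[ w < size R ] when (le R w z) (X w)
          ∎
        where
        open ≈-Reasoning
        open PolySolver using (solve; _:+_; _:=_)
        bot<z = ≢bot⇒bot< z≢bot
        S = ∑[ w < size R ] when (lt R (bot R) w ∧ lt R w z) (X w)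

  module _ {P Q : RankedPoset} where
    open ProductPoset P Q

    private
      when-∧-* : ∀ c d α β A B →
                 when (c ∧ d) (qpow (α ℕ.+ β) * (A * B)) ≈ when c (qpow α * A) * when d (qpow β * B)
      when-∧-* true  true  α β A B =
        ≈-trans (*-congʳ (qpow-+ α β)) (solve 4 (λ x y a b → x :* y :* (a :* b) := x :* a :* (y :* b)) ≈-refl _ _ A B)
        where open PolySolver using (solve; _:*_; _:=_)
      when-∧-* true  false α β A B = ≈-sym (zeroʳ _)
      when-∧-* false d     α β A B = ≈-sym (zeroˡ _)

    -- The lower set of (x, y) in P × Q is the product of the lower sets of x and y.
    ×-isMultichainSeries : ∀ {F G} → IsMultichainSeries P F → IsMultichainSeries Q G →
                           IsMultichainSeries (P ×ᴾ Q) (λ z → F (proj₁ (split z)) * G (proj₂ (split z)))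
    ×-isMultichainSeries {F} {G} isF isG = record { at-bot = at-bot ; recurrence = recurrence }
      where
      module F = IsMultichainSeries isF
      module G = IsMultichainSeries isG
      FG : Fin (size P) × Fin (size Q) → Poly
      FG (a , b) = F a * G b
      at-bot : FG (split (bot (P ×ᴾ Q))) ≈ 1ₚ
      at-bot = ≈-trans (≈-reflexive (cong FG (split-combine (bot P) (bot Q))))
                       (≈-trans (*-cong F.at-bot G.at-bot) (*-identityˡ 1ₚ))
      recurrence : ∀ z → FG (split z)
                         ≈ ∑[ w < size P ℕ.* size Q ] when (le (P ×ᴾ Q) w z) (qpow (rk (P ×ᴾ Q) w) * FG (split w))
      recurrence z = begin
        F x * G y
          ≈⟨ *-cong (F.recurrence x) (G.recurrence y) ⟩
        (∑[ a < size P ] A a) * (∑[ b < size Q ] B b)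
          ≈⟨ *-distribʳ-sum (∑[ b < size Q ] B b) A ⟩
        ∑[ a < size P ] (A a * ∑[ b < size Q ] B b)
          ≈⟨ sum-cong-≋ {size P} (λ a → *-distribˡ-sum (A a) B) ⟩
        ∑[ a < size P ] ∑[ b < size Q ] (A a * B b)
          ≈⟨ sum-cong-≋ {size P} (λ a → sum-cong-≋ {size Q} λ b →
               when-∧-* (le P a x) (le Q b y) (rk P a) (rk Q b) (F a) (G b)) ⟨
        ∑[ a < size P ] ∑[ b < size Q ] H (a , b)
          ≈⟨ sum-cong-≋ {size P} (λ a → sum-cong-≋ {size Q} λ b → ≈-reflexive (cong H (split-combine a b))) ⟨
        ∑[ a < size P ] ∑[ b < size Q ] H (split (Fin.combine a b))
          ≈⟨ ∑-combine (size P) (size Q) (H ∘ split) ⟨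
        ∑[ w < size P ℕ.* size Q ] H (split w)
          ∎
        where
        open ≈-Reasoning
        x = proj₁ (split z)
        y = proj₂ (split z)
        A : Fin (size P) → Poly
        A a = when (le P a x) (qpow (rk P a) * F a)
        B : Fin (size Q) → Poly
        B b = when (le Q b y) (qpow (rk Q b) * G b)
        H : Fin (size P) × Fin (size Q) → Poly
        H (a , b) = when (le P a x ∧ le Q b y) (qpow (rk P a ℕ.+ rk Q b) * (F a * G b))

  multichainSeries-× : ∀ {P Q} → IsRanked P → IsRanked Q →
    multichainSeries (P ×ᴾ Q) (top (P ×ᴾ Q)) ≈ multichainSeries P (top P) * multichainSeries Q (top Q)
  multichainSeries-× {P} {Q} rankedP rankedQ = ≈-trans
    (multichainSeries-unique rankedPQ (multichainSeries-isMultichainSeries rankedPQ)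
      (×-isMultichainSeries (multichainSeries-isMultichainSeries rankedP) (multichainSeries-isMultichainSeries rankedQ))
      (top (P ×ᴾ Q)))
    (≈-reflexive (cong (λ (a , b) → multichainSeries P a * multichainSeries Q b)
                       (ProductPoset.split-combine P Q (top P) (top Q))))
    where
    rankedPQ = ×-isRanked rankedP rankedQ

  pochhammer-*-geometric : ∀ r → pochhammer 1 r * geometric r ≈ pochhammer 1 (r ∸ 1)
  pochhammer-*-geometric zero    = ≈-trans (*-identityˡ (geometric 0)) geometric-zero
  pochhammer-*-geometric (suc r) = begin
    pochhammer 1 (suc r) * geometric (suc r)                ≈⟨ *-congʳ (pochhammer-snoc 1 r) ⟩
    pochhammer 1 r * 1-q^ (suc r) * geometric (suc r)       ≈⟨ *-assoc _ _ _ ⟩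
    pochhammer 1 r * (1-q^ (suc r) * geometric (suc r))     ≈⟨ *-congˡ (1-q^-*-geometric (s≤s z≤n)) ⟩
    pochhammer 1 r * 1ₚ                                     ≈⟨ *-identityʳ _ ⟩
    pochhammer 1 r                                          ∎
    where open ≈-Reasoning

  Θ-Ψ-multichain : ∀ R → Θ (Ψ R) ≈ pochhammer 1 (rank R) * multichainSeries R (top R)
  Θ-Ψ-multichain R = begin
    Θ (Ψ R)
      ≈⟨ Θ-Ψ R ⟩
    AbIndex.flagSum R (bot R) 1 (rank R ∸ 1)
      ≈⟨ Chains.pochhammer-*-chainSum R (rank R ∸ 1) (bot R) 0 ⟨
    pochhammer 1 (rank R ∸ 1) * C
      ≈⟨ *-congʳ (pochhammer-*-geometric (rank R)) ⟨
    pochhammer 1 (rank R) * geometric (rank R) * C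
      ≈⟨ *-assoc _ _ _ ⟩
    pochhammer 1 (rank R) * multichainSeries R (top R)
      ∎
    where
    open ≈-Reasoning
    C = Chains.chainSum R (bot R) (top R) 1 (rank R ∸ 1)

open Series hiding (_+_)
open Multichains
open import Algebra.Properties.Semiring.Exp (CommutativeRing.semiring PolyRing) using (^-homo-*)
open import Data.Nat using (_+_)

ΘΨ-× : ∀ {P Q} → IsRanked P → IsRanked Q →
       qfact (rank P) * qfact (rank Q) * Θ (Ψ (P ×ᴾ Q)) ≈ qfact (rank P + rank Q) * (Θ (Ψ P) * Θ (Ψ Q))
ΘΨ-× {P} {Q} rankedP rankedQ = [1-q]^-*-cancelˡ (m + n) (begin
  [1-q]^ (m + n) * ([ m ]! * [ n ]! * Θ (Ψ (P ×ᴾ Q)))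
    ≈⟨ *-cong (^-homo-* (1-q^ 1) m n) (*-congˡ ΘΨ-PQ) ⟩
  [1-q]^ m * [1-q]^ n * ([ m ]! * [ n ]! * (E (m + n) * (M P * M Q)))
    ≈⟨ solve 7 (λ εm εn fm fn E Mp Mq → εm :* εn :* (fm :* fn :* (E :* (Mp :* Mq)))
                                        := E :* (εm :* fm :* Mp :* (εn :* fn :* Mq)))
               ≈-refl ([1-q]^ m) ([1-q]^ n) [ m ]! [ n ]! (E (m + n)) (M P) (M Q) ⟩
  E (m + n) * ([1-q]^ m * [ m ]! * M P * ([1-q]^ n * [ n ]! * M Q))
    ≈⟨ *-cong (pochhammer-qfact (m + n)) (*-cong (ΘΨ P) (ΘΨ Q)) ⟩
  [1-q]^ (m + n) * [ m + n ]! * (Θ (Ψ P) * Θ (Ψ Q))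
    ≈⟨ *-assoc _ _ _ ⟩
  [1-q]^ (m + n) * ([ m + n ]! * (Θ (Ψ P) * Θ (Ψ Q)))
    ∎)
  where
  open ≈-Reasoning
  open PolySolver using (solve; _:*_; _:=_)
  m = rank P
  n = rank Q
  [1-q]^ : ℕ → Poly
  [1-q]^ k = (1-q^ 1) ^ k
  [_]! : ℕ → Poly
  [_]! = qfact
  E : ℕ → Poly
  E = pochhammer 1
  M : (R : RankedPoset) → Poly
  M R = multichainSeries R (top R)
  ΘΨ-PQ : Θ (Ψ (P ×ᴾ Q)) ≈ E (m + n) * (M P * M Q)
  ΘΨ-PQ = ≈-trans (Θ-Ψ-multichain (P ×ᴾ Q))
                  (*-cong (≈-reflexive (cong E (ProductPoset.rank-× P Q))) (multichainSeries-× rankedP rankedQ))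
  ΘΨ : ∀ R → [1-q]^ (rank R) * [ rank R ]! * M R ≈ Θ (Ψ R)
  ΘΨ R = ≈-trans (*-congʳ (≈-sym (pochhammer-qfact (rank R)))) (≈-sym (Θ-Ψ-multichain R))

mainTheorem7 : (P Q : RankedPoset) → IsGraded P → IsGraded Q →
    (qfact (rank P) *ₚ qfact (rank Q)) *ₚ Θ (Ψ (P ×ᴾ Q))
    ≈ₚ qfact (rank P + rank Q) *ₚ (Θ (Ψ P) *ₚ Θ (Ψ Q))
mainTheorem7 P Q gradedP gradedQ =
  coeff (subst₂ _≈_ (unfold (qfact (rank P)) (qfact (rank Q)) (Θ (Ψ (P ×ᴾ Q))))
                    (trans (*≡*ₚ _ _) (cong (qfact (rank P + rank Q) *ₚ_) (*≡*ₚ (Θ (Ψ P)) (Θ (Ψ Q)))))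
                    (ΘΨ-× (graded⇒ranked gradedP) (graded⇒ranked gradedQ)))
  where
  unfold : ∀ f g h → f * g * h ≡ (f *ₚ g) *ₚ h
  unfold f g h = trans (*≡*ₚ (f * g) h) (cong (_*ₚ h) (*≡*ₚ f g))
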